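{- Let $m\ge1$, $k\ge1$ and $h\le k-1$ be integers. The generating function for the number of partitions $\lambda$ of $n$ into distinct odd parts with an $h$-fixed hook in the $m$th column that arises from a hook of size $k$ (i.e. the row $s=k-h$ satisfies $\lambda_s\ge m$ and $h_{s,m}(\lambda)=k$) is \[ \sum_{\substack{l=\lceil\frac{2k-1}{3}\rceil\\ l\ \mathrm{odd}}}^{k}\frac{q^{(m-1)(2k-h-l)+k+l(k-h-1)+2\binom{k-h}{2}+2\binom{k-l}{2}}\,(-q;q^2)_{\frac{m-1}{2}}}{(q^2;q^2)_{k-h-1}}\binom{k-l+\frac{3l-2k-1}{2}}{k-l}_{q^2} \] if $m$ is odd, and \[ \sum_{\substack{l=\lceil\frac{2k}{3}\rceil\\ l\ \mathrm{even}}}^{k}\frac{q^{k-l+(m-1)(2k-h-l)+k+l(k-h-1)+2\binom{k-h}{2}+2\binom{k-l}{2}}\,(-q;q^2)_{\frac{m}{2}}}{(q^2;q^2)_{k-h-1}}\binom{k-l+\frac{3l-2k-2}{2}}{k-l}_{q^2} \] if $m$ is even.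
   Context: For a partition $\lambda$ with conjugate $\lambda'$, $h_{i,j}(\lambda)=\lambda_i+\lambda'_j-i-j+1$ is the hook length of cell $(i,j)$, $j\le\lambda_i$. An $h$-fixed hook in the $m$th column is a row $i$ with $\lambda_i\ge m$ and $h_{i,m}(\lambda)=i+h$. Notation: $(a;b)_n=\prod_{t=0}^{n-1}(1-ab^t)$; $\binom{x}{2}=x(x-1)/2$; $\binom{a}{b}_{q^2}$ is the Gaussian binomial coefficient $\frac{(q;q)_a}{(q;q)_b(q;q)_{a-b}}$ with $q$ replaced by $q^2$, taken to be $0$ unless $0\le b\le a$. -}

module Defs where

open import Data.Nat as ℕ using (ℕ; zero; suc; _≤_; _≤?_; _∸_; _%_)
open import Data.Nat.Divisibility using (_∣?_)
import Data.Nat.DivMod as ℕD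
open import Data.Integer as ℤ using (ℤ; +_; ∣_∣; 1ℤ; 0ℤ)
open import Data.Integer.DivMod using () renaming (_/_ to _/ℤ_)
open import Data.List using (List; []; _∷_; upTo; foldr; map; filter; length)
open import Data.Nat.ListAction using (sum)
open import Data.List.Relation.Unary.All using (All)
open import Data.List.Relation.Unary.Linked using (Linked)
open import Data.Product using (Σ; _×_)
open import Relation.Nullary using (Dec; yes; no; does)
open import Relation.Nullary.Decidable using (_×-dec_)
open import Relation.Binary.PropositionalEquality using (_≡_)
open import Data.Bool using (if_then_else_)

-- Formal power series over ℤ in q, as coefficient functions.

PS : Set
PS = ℕ → ℤ

0ₚ : PS
0ₚ _ = 0ℤ

1ₚ : PS
1ₚ zero    = 1ℤ
1ₚ (suc _) = 0ℤ

infixl 6 _+ₚ_ _-ₚ_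
infixl 7 _*ₚ_ _·ₚ_

_+ₚ_ : PS → PS → PS
(f +ₚ g) n = f n ℤ.+ g n

_-ₚ_ : PS → PS → PS
(f -ₚ g) n = f n ℤ.- g n

_·ₚ_ : ℤ → PS → PS
(c ·ₚ f) n = c ℤ.* f n

_*ₚ_ : PS → PS → PS
(f *ₚ g) n = foldr ℤ._+_ 0ℤ (map (λ i → f i ℤ.* g (n ∸ i)) (upTo (suc n)))

Σₚ : List ℕ → (ℕ → PS) → PS
Σₚ xs f = foldr (λ x acc → f x +ₚ acc) 0ₚ xs

Πₚ : List ℕ → (ℕ → PS) → PS
Πₚ xs f = foldr (λ x acc → f x *ₚ acc) 1ₚ xs

qⁿ : ℕ → PS
qⁿ e n = if does (n ℕ.≟ e) then 1ℤ else 0ℤ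

-- monomial q^e with integer exponent (the zero series if e < 0;
-- never happens in the theorem, where all exponents are ≥ 0)
qᶻ : ℤ → PS
qᶻ e n = if does (+ n ℤ.≟ e) then 1ℤ else 0ℤ

-- q-Pochhammer (a q^e ; q^d)_n = ∏_{t<n} (1 - a q^(e + d t)), a ∈ ℤ
qpoch : ℤ → ℕ → ℕ → ℕ → PS
qpoch a e d n = Πₚ (upTo n) (λ t → 1ₚ -ₚ a ·ₚ qⁿ (e ℕ.+ d ℕ.* t))

-- power series inverse of (1 - a q^(suc f)) : Σ_j a^j q^((suc f) j)
geomInv : ℤ → ℕ → PS
geomInv a f n = if does (suc f ∣? n) then a ℤ.^ (n ℕD./ suc f) else 0ℤ

-- power series inverse of (a q^(suc e) ; q^d)_n
qpochInv : ℤ → ℕ → ℕ → ℕ → PS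
qpochInv a e d n = Πₚ (upTo n) (λ t → geomInv a (e ℕ.+ d ℕ.* t))

q2q2 : ℕ → PS
q2q2 n = qpoch 1ℤ 2 2 n

q2q2Inv : ℕ → PS
q2q2Inv n = qpochInv 1ℤ 1 2 n     -- exponents suc (1 + 2t) = 2 + 2t

-- Gaussian binomial [a choose b]_{q^2} = (q^2;q^2)_a / ((q^2;q^2)_b (q^2;q^2)_{a-b}),
-- zero unless 0 ≤ b ≤ a
gaussN : ℕ → ℕ → PS
gaussN a b with b ≤? a
... | yes _ = q2q2 a *ₚ q2q2Inv b *ₚ q2q2Inv (a ∸ b)
... | no  _ = 0ₚ

gauss2 : ℤ → ℤ → PS
gauss2 (+ a) (+ b) = gaussN a b
gauss2 _     _     = 0ₚ

choose2 : ℤ → ℤ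
choose2 x = (x ℤ.* (x ℤ.- 1ℤ)) /ℤ + 2

ceil3 : ℕ → ℕ
ceil3 a = (a ℕ.+ 2) ℕD./ 3

expo : ℕ → ℕ → ℤ → ℕ → ℤ
expo m k h l =
  (+ m ℤ.- 1ℤ) ℤ.* (+ 2 ℤ.* + k ℤ.- h ℤ.- + l) ℤ.+ + k
  ℤ.+ + l ℤ.* (+ k ℤ.- h ℤ.- 1ℤ)
  ℤ.+ + 2 ℤ.* choose2 (+ k ℤ.- h) ℤ.+ + 2 ℤ.* choose2 (+ k ℤ.- + l)

GFodd : ℕ → ℕ → ℤ → PS
GFodd m k h =
  Σₚ (filter (λ l → (ceil3 (2 ℕ.* k ∸ 1) ≤? l) ×-dec (l % 2 ℕ.≟ 1)) (upTo (suc k)))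
     (λ l → qᶻ (expo m k h l)
            *ₚ qpoch (ℤ.- 1ℤ) 1 2 ((m ∸ 1) ℕD./ 2)
            *ₚ q2q2Inv ∣ + k ℤ.- h ℤ.- 1ℤ ∣
            *ₚ gauss2 (+ k ℤ.- + l ℤ.+ ((+ 3 ℤ.* + l ℤ.- + 2 ℤ.* + k ℤ.- 1ℤ) /ℤ + 2))
                      (+ k ℤ.- + l))

GFeven : ℕ → ℕ → ℤ → PS
GFeven m k h =
  Σₚ (filter (λ l → (ceil3 (2 ℕ.* k) ≤? l) ×-dec (l % 2 ℕ.≟ 0)) (upTo (suc k)))
     (λ l → qᶻ (+ k ℤ.- + l ℤ.+ expo m k h l)
            *ₚ qpoch (ℤ.- 1ℤ) 1 2 (m ℕD./ 2)
            *ₚ q2q2Inv ∣ + k ℤ.- h ℤ.- 1ℤ ∣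
            *ₚ gauss2 (+ k ℤ.- + l ℤ.+ ((+ 3 ℤ.* + l ℤ.- + 2 ℤ.* + k ℤ.- + 2) /ℤ + 2))
                      (+ k ℤ.- + l))

GF : ℕ → ℕ → ℤ → PS
GF m k h = if does (m % 2 ℕ.≟ 1) then GFodd m k h else GFeven m k h

-- a partition is the list of its parts λ₁ > λ₂ > ... (distinct, hence strictly decreasing)
Odd : ℕ → Set
Odd x = x % 2 ≡ 1

DistinctOddPartition : ℕ → List ℕ → Set
DistinctOddPartition n λs = Linked ℕ._>_ λs × All Odd λs × sum λs ≡ n

-- λ_i (1-based), 0 beyond the length
part : List ℕ → ℕ → ℕ
part []       _             = 0
part (x ∷ xs) zero          = 0
part (x ∷ xs) (suc zero)    = x
part (x ∷ xs) (suc (suc i)) = part xs (suc i)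

conj : List ℕ → ℕ → ℕ
conj λs j = length (filter (j ≤?_) λs)

hook : List ℕ → ℕ → ℕ → ℤ
hook λs i j = + part λs i ℤ.+ + conj λs j ℤ.- + i ℤ.- + j ℤ.+ 1ℤ

Counted : ℕ → ℕ → ℤ → ℕ → Set
Counted m k h n =
  Σ (List ℕ) λ λs → DistinctOddPartition n λs
    × m ≤ part λs ∣ + k ℤ.- h ∣
    × hook λs ∣ + k ℤ.- h ∣ m ≡ + k

{-# OPTIONS --safe #-}
-- Cut a partition into distinct odd parts at the row s = k − h of the hook: the s − 1 parts above
-- λ_s, the part λ_s = l + m − 1 itself (l − 1 is the arm of the hook), the k − l parts in [m, λ_s)
-- (its leg) and the parts below m.  For fixed l these pieces vary independently.  The parts below m
-- form a subset of the odd numbers below m, counted by (−q;q²)_⌊m/2⌋.  Those above λ_s are determined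
-- by s − 1 free even gaps, counted by 1/(q²;q²)_{s−1}.  The leg is a (k − l)-subset of the ⌊(l − 1)/2⌋
-- odd numbers in [m, λ_s); splitting off its largest possible element gives the q-Pascal recurrence,
-- so it is counted by the Gaussian binomial in q², once that quotient of (q²;q²)-products is shown to
-- satisfy the recurrence.  The power of q in each summand is the size of the smallest configuration.
module Submission where

open import Data.Nat using (ℕ)
import Data.Nat as Nat
open import Data.Product using (Σ)
open import Relation.Binary.PropositionalEquality using (_≡_)

module PowerSeries where

  open import Defs
  open import Data.Nat as ℕ using (zero; suc; _∸_; z≤n; s≤s; _≟_)
  import Data.Nat.Properties as ℕₚ
  open import Data.Integer as ℤ using (ℤ; +_; 0ℤ; 1ℤ; _+_; _*_; -_; _-_)
  import Data.Integer.Properties as ℤₚ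
  open import Data.Integer.Tactic.RingSolver using (solve-∀)
  open import Data.List using (foldr; applyUpTo)
  import Data.List.Properties as Listₚ
  open import Data.Bool using (if_then_else_)
  open import Data.Product using (_,_)
  open import Data.Maybe using (Maybe; just; nothing)
  open import Function using (_∘_)
  open import Function.Bundles using (mk⇔)
  open import Relation.Nullary using (yes; no; does; ¬_)
  open import Relation.Nullary.Decidable using (dec-false; does-⇔)
  open import Relation.Binary.PropositionalEquality
  open import Algebra.Bundles using (CommutativeRing)
  open import Algebra.Structures using (IsCommutativeRing)
  open import Algebra.Solver.Ring.AlmostCommutativeRing
    using (AlmostCommutativeRing; fromCommutativeRing; _-Raw-AlmostCommutative⟶_)
  open ≡-Reasoning

  ∑< : ℕ → (ℕ → ℤ) → ℤ
  ∑< zero    F = 0ℤ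
  ∑< (suc n) F = F 0 + ∑< n (F ∘ suc)

  ∑-cong : ∀ n {F G : ℕ → ℤ} → (∀ i → i ℕ.< n → F i ≡ G i) → ∑< n F ≡ ∑< n G
  ∑-cong zero    eq = refl
  ∑-cong (suc n) eq = cong₂ _+_ (eq 0 (s≤s z≤n)) (∑-cong n (λ i i<n → eq (suc i) (s≤s i<n)))

  ∑-zero : ∀ n {F : ℕ → ℤ} → (∀ i → i ℕ.< n → F i ≡ 0ℤ) → ∑< n F ≡ 0ℤ
  ∑-zero n eq = trans (∑-cong n eq) (zeros n)
    where
    zeros : ∀ n → ∑< n (λ _ → 0ℤ) ≡ 0ℤ
    zeros zero    = refl
    zeros (suc n) = trans (ℤₚ.+-identityˡ _) (zeros n)

  ∑-distrib-+ : ∀ n (F G : ℕ → ℤ) → ∑< n (λ i → F i + G i) ≡ ∑< n F + ∑< n G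
  ∑-distrib-+ zero    F G = refl
  ∑-distrib-+ (suc n) F G =
    trans (cong (_+_ (F 0 + G 0)) (∑-distrib-+ n (F ∘ suc) (G ∘ suc))) (interchange (F 0) (G 0) _ _)
    where
    interchange : ∀ a b c d → (a + b) + (c + d) ≡ (a + c) + (b + d)
    interchange = solve-∀

  ∑-distribˡ-* : ∀ n c (F : ℕ → ℤ) → c * ∑< n F ≡ ∑< n (λ i → c * F i)
  ∑-distribˡ-* zero    c F = ℤₚ.*-zeroʳ c
  ∑-distribˡ-* (suc n) c F = trans (ℤₚ.*-distribˡ-+ c (F 0) _) (cong (_+_ (c * F 0)) (∑-distribˡ-* n c (F ∘ suc)))

  ∑-distribʳ-* : ∀ n c (F : ℕ → ℤ) → ∑< n F * c ≡ ∑< n (λ i → F i * c)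
  ∑-distribʳ-* n c F = begin
    ∑< n F * c                ≡⟨ ℤₚ.*-comm _ c ⟩
    c * ∑< n F                ≡⟨ ∑-distribˡ-* n c F ⟩
    ∑< n (λ i → c * F i)      ≡⟨ ∑-cong n (λ i _ → ℤₚ.*-comm c (F i)) ⟩
    ∑< n (λ i → F i * c)      ∎

  ∑-snoc : ∀ n (F : ℕ → ℤ) → ∑< (suc n) F ≡ ∑< n F + F n
  ∑-snoc zero    F = trans (ℤₚ.+-identityʳ (F 0)) (sym (ℤₚ.+-identityˡ (F 0)))
  ∑-snoc (suc n) F = trans (cong (_+_ (F 0)) (∑-snoc n (F ∘ suc))) (sym (ℤₚ.+-assoc (F 0) _ _))

  ∑-reverse : ∀ n (F : ℕ → ℤ) → ∑< n F ≡ ∑< n (λ i → F (n ∸ suc i))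
  ∑-reverse zero    F = refl
  ∑-reverse (suc n) F = begin
    F 0 + ∑< n (F ∘ suc)                                   ≡⟨ cong (_+_ (F 0)) (∑-reverse n (F ∘ suc)) ⟩
    F 0 + ∑< n (λ i → F (suc (n ∸ suc i)))                 ≡⟨ ℤₚ.+-comm (F 0) _ ⟩
    ∑< n (λ i → F (suc (n ∸ suc i))) + F 0                 ≡⟨ cong₂ _+_ (∑-cong n (λ i i<n → cong F (sym (ℕₚ.+-∸-assoc 1 i<n))))
                                                                         (cong F (sym (ℕₚ.n∸n≡0 n))) ⟩
    ∑< n (λ i → F (suc n ∸ suc i)) + F (suc n ∸ suc n)     ≡⟨ ∑-snoc n (λ i → F (suc n ∸ suc i)) ⟨
    ∑< (suc n) (λ i → F (suc n ∸ suc i))                   ∎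

  -- The triangle {i ≤ a < N} read by columns and by rows, with a = i + b.
  ∑-triangle : ∀ N (F : ℕ → ℕ → ℤ) →
    ∑< N (λ a → ∑< (suc a) (λ i → F i a)) ≡ ∑< N (λ i → ∑< (N ∸ i) (λ b → F i (i ℕ.+ b)))
  ∑-triangle zero    F = refl
  ∑-triangle (suc N) F = begin
    ∑< (suc N) (λ a → ∑< (suc a) (λ i → F i a))
      ≡⟨ ∑-snoc N _ ⟩
    ∑< N (λ a → ∑< (suc a) (λ i → F i a)) + ∑< (suc N) (λ i → F i N)
      ≡⟨ cong₂ _+_ (∑-triangle N F) (∑-snoc N (λ i → F i N)) ⟩
    Rows N + (∑< N (λ i → F i N) + F N N)
      ≡⟨ ℤₚ.+-assoc (Rows N) _ _ ⟨
    (Rows N + ∑< N (λ i → F i N)) + F N N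
      ≡⟨ cong₂ _+_ (sym (∑-distrib-+ N _ _)) (cong (F N) (sym (ℕₚ.+-identityʳ N))) ⟩
    ∑< N (λ i → ∑< (N ∸ i) (λ b → F i (i ℕ.+ b)) + F i N) + F N (N ℕ.+ 0)
      ≡⟨ cong (_+ F N (N ℕ.+ 0)) (∑-cong N extend-row) ⟩
    ∑< N (λ i → ∑< (suc N ∸ i) (λ b → F i (i ℕ.+ b))) + F N (N ℕ.+ 0)
      ≡⟨ cong (_+_ (∑< N (λ i → ∑< (suc N ∸ i) (λ b → F i (i ℕ.+ b)))))
              (trans (sym (ℤₚ.+-identityʳ _)) (cong (λ t → ∑< t (λ b → F N (N ℕ.+ b))) (sym (ℕₚ.m+n∸n≡m 1 N)))) ⟩
    ∑< N (λ i → ∑< (suc N ∸ i) (λ b → F i (i ℕ.+ b))) + ∑< (suc N ∸ N) (λ b → F N (N ℕ.+ b))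
      ≡⟨ ∑-snoc N _ ⟨
    ∑< (suc N) (λ i → ∑< (suc N ∸ i) (λ b → F i (i ℕ.+ b)))
      ∎
    where
    Rows : ℕ → ℤ
    Rows N = ∑< N (λ i → ∑< (N ∸ i) (λ b → F i (i ℕ.+ b)))
    extend-row : ∀ i → i ℕ.< N →
      ∑< (N ∸ i) (λ b → F i (i ℕ.+ b)) + F i N ≡ ∑< (suc N ∸ i) (λ b → F i (i ℕ.+ b))
    extend-row i i<N = begin
      ∑< (N ∸ i) (λ b → F i (i ℕ.+ b)) + F i N
        ≡⟨ cong (λ t → ∑< (N ∸ i) (λ b → F i (i ℕ.+ b)) + F i t) (sym (ℕₚ.m+[n∸m]≡n (ℕₚ.<⇒≤ i<N))) ⟩
      ∑< (N ∸ i) (λ b → F i (i ℕ.+ b)) + F i (i ℕ.+ (N ∸ i))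
        ≡⟨ ∑-snoc (N ∸ i) _ ⟨
      ∑< (suc (N ∸ i)) (λ b → F i (i ℕ.+ b))
        ≡⟨ cong (λ t → ∑< t (λ b → F i (i ℕ.+ b))) (sym (ℕₚ.+-∸-assoc 1 (ℕₚ.<⇒≤ i<N))) ⟩
      ∑< (suc N ∸ i) (λ b → F i (i ℕ.+ b))
        ∎

  δ : ℕ → ℕ → ℤ
  δ a b = if does (a ≟ b) then 1ℤ else 0ℤ

  δ-≢ : ∀ {a b} → ¬ a ≡ b → δ a b ≡ 0ℤ
  δ-≢ {a} {b} a≢b = cong (if_then 1ℤ else 0ℤ) (dec-false (a ≟ b) a≢b)

  ∑-δ : ∀ n c (X : ℕ → ℤ) → c ℕ.< n → ∑< n (λ i → δ i c * X i) ≡ X c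
  ∑-δ (suc n) zero    X _         = begin
    1ℤ * X 0 + ∑< n (λ i → 0ℤ)    ≡⟨ cong₂ _+_ (ℤₚ.*-identityˡ (X 0)) (∑-zero n (λ _ _ → refl)) ⟩
    X 0 + 0ℤ                       ≡⟨ ℤₚ.+-identityʳ (X 0) ⟩
    X 0                            ∎
  ∑-δ (suc n) (suc c) X (s≤s c<n) = trans (ℤₚ.+-identityˡ _) (∑-δ n c (X ∘ suc) c<n)

  ∑-δ-outside : ∀ n c (X : ℕ → ℤ) → n ℕ.≤ c → ∑< n (λ i → δ i c * X i) ≡ 0ℤ
  ∑-δ-outside zero    c       X _         = refl
  ∑-δ-outside (suc n) (suc c) X (s≤s n≤c) = trans (ℤₚ.+-identityˡ _) (∑-δ-outside n c (X ∘ suc) n≤c)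

  *ₚ-unfold : ∀ f g n → (f *ₚ g) n ≡ ∑< (suc n) (λ i → f i * g (n ∸ i))
  *ₚ-unfold f g n = trans (cong (foldr _+_ 0ℤ) (Listₚ.map-upTo F (suc n))) (foldr-applyUpTo (suc n) F)
    where
    F : ℕ → ℤ
    F i = f i * g (n ∸ i)
    foldr-applyUpTo : ∀ n (F : ℕ → ℤ) → foldr _+_ 0ℤ (applyUpTo F n) ≡ ∑< n F
    foldr-applyUpTo zero    F = refl
    foldr-applyUpTo (suc n) F = cong (_+_ (F 0)) (foldr-applyUpTo n (F ∘ suc))

  -- A record rather than _≗_: unification must not unfold _*ₚ_ at a coefficient while solving for
  -- the factors of a product in equational reasoning about series.
  infix 4 _≈_
  record _≈_ (f g : PS) : Set where
    constructor coeffwise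
    field
      coeff : ∀ n → f n ≡ g n
  open _≈_ public

  *ₚ-comm : ∀ f g → f *ₚ g ≈ g *ₚ f
  *ₚ-comm f g = coeffwise coefficient
    where
    swap : ∀ {n} i → i ℕ.< suc n → f (n ∸ i) * g (n ∸ (n ∸ i)) ≡ g i * f (n ∸ i)
    swap {n} i (s≤s i≤n) = trans (cong (λ j → f (n ∸ i) * g j) (ℕₚ.m∸[m∸n]≡n i≤n)) (ℤₚ.*-comm (f (n ∸ i)) (g i))
    coefficient : ∀ n → (f *ₚ g) n ≡ (g *ₚ f) n
    coefficient n = begin
      (f *ₚ g) n                                       ≡⟨ *ₚ-unfold f g n ⟩
      ∑< (suc n) (λ i → f i * g (n ∸ i))               ≡⟨ ∑-reverse (suc n) (λ i → f i * g (n ∸ i)) ⟩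
      ∑< (suc n) (λ i → f (n ∸ i) * g (n ∸ (n ∸ i)))   ≡⟨ ∑-cong (suc n) swap ⟩
      ∑< (suc n) (λ i → g i * f (n ∸ i))               ≡⟨ *ₚ-unfold g f n ⟨
      (g *ₚ f) n                                       ∎

  *ₚ-cong : ∀ {f f′ g g′} → f ≈ f′ → g ≈ g′ → f *ₚ g ≈ f′ *ₚ g′
  *ₚ-cong {f} {f′} {g} {g′} (coeffwise f≈f′) (coeffwise g≈g′) = coeffwise coefficient
    where
    coefficient : ∀ n → (f *ₚ g) n ≡ (f′ *ₚ g′) n
    coefficient n = begin
      (f *ₚ g) n                              ≡⟨ *ₚ-unfold f g n ⟩
      ∑< (suc n) (λ i → f i * g (n ∸ i))      ≡⟨ ∑-cong (suc n) (λ i _ → cong₂ _*_ (f≈f′ i) (g≈g′ (n ∸ i))) ⟩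
      ∑< (suc n) (λ i → f′ i * g′ (n ∸ i))    ≡⟨ *ₚ-unfold f′ g′ n ⟨
      (f′ *ₚ g′) n                            ∎

  *ₚ-distribʳ-+ₚ : ∀ h f g → (f +ₚ g) *ₚ h ≈ (f *ₚ h) +ₚ (g *ₚ h)
  *ₚ-distribʳ-+ₚ h f g = coeffwise coefficient
    where
    coefficient : ∀ n → ((f +ₚ g) *ₚ h) n ≡ ((f *ₚ h) +ₚ (g *ₚ h)) n
    coefficient n = begin
      ((f +ₚ g) *ₚ h) n
        ≡⟨ *ₚ-unfold (f +ₚ g) h n ⟩
      ∑< (suc n) (λ i → (f i + g i) * h (n ∸ i))
        ≡⟨ ∑-cong (suc n) (λ i _ → ℤₚ.*-distribʳ-+ (h (n ∸ i)) (f i) (g i)) ⟩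
      ∑< (suc n) (λ i → f i * h (n ∸ i) + g i * h (n ∸ i))
        ≡⟨ ∑-distrib-+ (suc n) (λ i → f i * h (n ∸ i)) (λ i → g i * h (n ∸ i)) ⟩
      ∑< (suc n) (λ i → f i * h (n ∸ i)) + ∑< (suc n) (λ i → g i * h (n ∸ i))
        ≡⟨ cong₂ _+_ (*ₚ-unfold f h n) (*ₚ-unfold g h n) ⟨
      ((f *ₚ h) +ₚ (g *ₚ h)) n
        ∎

  *ₚ-identityˡ : ∀ f → 1ₚ *ₚ f ≈ f
  *ₚ-identityˡ f = coeffwise coefficient
    where
    coefficient : ∀ n → (1ₚ *ₚ f) n ≡ f n
    coefficient n = begin
      (1ₚ *ₚ f) n                                ≡⟨ *ₚ-unfold 1ₚ f n ⟩
      1ℤ * f n + ∑< n (λ i → 0ℤ * f (n ∸ suc i)) ≡⟨ cong₂ _+_ (ℤₚ.*-identityˡ (f n)) (∑-zero n (λ _ _ → refl)) ⟩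
      f n + 0ℤ                                   ≡⟨ ℤₚ.+-identityʳ (f n) ⟩
      f n                                        ∎

  *ₚ-assoc : ∀ f g h → (f *ₚ g) *ₚ h ≈ f *ₚ (g *ₚ h)
  *ₚ-assoc f g h = coeffwise coefficient
    where
    coefficient : ∀ n → ((f *ₚ g) *ₚ h) n ≡ (f *ₚ (g *ₚ h)) n
    coefficient n = begin
      ((f *ₚ g) *ₚ h) n
        ≡⟨ *ₚ-unfold (f *ₚ g) h n ⟩
      ∑< (suc n) (λ a → (f *ₚ g) a * h (n ∸ a))
        ≡⟨ ∑-cong (suc n) (λ a _ → trans (cong (_* h (n ∸ a)) (*ₚ-unfold f g a))
                                         (∑-distribʳ-* (suc a) (h (n ∸ a)) (λ i → f i * g (a ∸ i)))) ⟩
      ∑< (suc n) (λ a → ∑< (suc a) (λ i → F i a))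
        ≡⟨ ∑-triangle (suc n) F ⟩
      ∑< (suc n) (λ i → ∑< (suc n ∸ i) (λ b → F i (i ℕ.+ b)))
        ≡⟨ ∑-cong (suc n) row ⟩
      ∑< (suc n) (λ i → f i * (g *ₚ h) (n ∸ i))
        ≡⟨ *ₚ-unfold f (g *ₚ h) n ⟨
      (f *ₚ (g *ₚ h)) n
        ∎
      where
      F : ℕ → ℕ → ℤ
      F i a = f i * g (a ∸ i) * h (n ∸ a)
      row : ∀ i → i ℕ.< suc n → ∑< (suc n ∸ i) (λ b → F i (i ℕ.+ b)) ≡ f i * (g *ₚ h) (n ∸ i)
      row i (s≤s i≤n) = begin
        ∑< (suc n ∸ i) (λ b → F i (i ℕ.+ b))
          ≡⟨ cong (λ t → ∑< t (λ b → F i (i ℕ.+ b))) (ℕₚ.+-∸-assoc 1 i≤n) ⟩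
        ∑< (suc (n ∸ i)) (λ b → F i (i ℕ.+ b))
          ≡⟨ ∑-cong (suc (n ∸ i)) (λ b _ → trans (cong₂ (λ u v → f i * g u * h v) (ℕₚ.m+n∸m≡n i b) (sym (ℕₚ.∸-+-assoc n i b)))
                                                 (ℤₚ.*-assoc (f i) (g b) _)) ⟩
        ∑< (suc (n ∸ i)) (λ b → f i * (g b * h (n ∸ i ∸ b)))
          ≡⟨ ∑-distribˡ-* (suc (n ∸ i)) (f i) (λ b → g b * h (n ∸ i ∸ b)) ⟨
        f i * ∑< (suc (n ∸ i)) (λ b → g b * h (n ∸ i ∸ b))
          ≡⟨ cong (f i *_) (*ₚ-unfold g h (n ∸ i)) ⟨
        f i * (g *ₚ h) (n ∸ i)
          ∎

  negₚ : PS → PS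
  negₚ f n = - f n

  PS-isCommutativeRing : IsCommutativeRing _≈_ _+ₚ_ _*ₚ_ negₚ 0ₚ 1ₚ
  PS-isCommutativeRing = record
    { isRing = record
      { +-isAbelianGroup = record
        { isGroup = record
          { isMonoid = record
            { isSemigroup = record
              { isMagma = record
                { isEquivalence = record
                  { refl  = coeffwise (λ _ → refl)
                  ; sym   = λ p → coeffwise (λ n → sym (coeff p n))
                  ; trans = λ p q → coeffwise (λ n → trans (coeff p n) (coeff q n)) }
                ; ∙-cong = λ p q → coeffwise (λ n → cong₂ _+_ (coeff p n) (coeff q n)) }
              ; assoc = λ f g h → coeffwise (λ n → ℤₚ.+-assoc (f n) (g n) (h n)) }
            ; identity = (λ f → coeffwise (λ n → ℤₚ.+-identityˡ (f n))) , (λ f → coeffwise (λ n → ℤₚ.+-identityʳ (f n))) }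
          ; inverse = (λ f → coeffwise (λ n → ℤₚ.+-inverseˡ (f n))) , (λ f → coeffwise (λ n → ℤₚ.+-inverseʳ (f n)))
          ; ⁻¹-cong = λ p → coeffwise (λ n → cong -_ (coeff p n)) }
        ; comm = λ f g → coeffwise (λ n → ℤₚ.+-comm (f n) (g n)) }
      ; *-cong = *ₚ-cong
      ; *-assoc = *ₚ-assoc
      ; *-identity = *ₚ-identityˡ , (λ f → coeffwise (λ n → trans (coeff (*ₚ-comm f 1ₚ) n) (coeff (*ₚ-identityˡ f) n)))
      ; distrib = (λ h f g → coeffwise (λ n → trans (coeff (*ₚ-comm h (f +ₚ g)) n)
                     (trans (coeff (*ₚ-distribʳ-+ₚ h f g) n) (cong₂ _+_ (coeff (*ₚ-comm f h) n) (coeff (*ₚ-comm g h) n)))))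
                , *ₚ-distribʳ-+ₚ }
    ; *-comm = *ₚ-comm }

  PS-commutativeRing : CommutativeRing _ _
  PS-commutativeRing = record { isCommutativeRing = PS-isCommutativeRing }

  private
    ℤ⟶PS : ℤ.+-*-rawRing -Raw-AlmostCommutative⟶ fromCommutativeRing PS-commutativeRing
    ℤ⟶PS = record
      { ⟦_⟧    = λ c → c ·ₚ 1ₚ
      ; +-homo = λ c d → coeffwise (λ n → ℤₚ.*-distribʳ-+ (1ₚ n) c d)
      ; *-homo = λ c d → coeffwise (λ n → sym (trans (*ₚ-unfold (c ·ₚ 1ₚ) (d ·ₚ 1ₚ) n) (constant-product c d n)))
      ; -‿homo = λ c → coeffwise (λ n → sym (ℤₚ.neg-distribˡ-* c (1ₚ n)))
      ; 0-homo = coeffwise (λ _ → refl)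
      ; 1-homo = coeffwise (λ n → ℤₚ.*-identityˡ (1ₚ n))
      }
      where
      constant-product : ∀ c d n → ∑< (suc n) (λ i → (c ·ₚ 1ₚ) i * (d ·ₚ 1ₚ) (n ∸ i)) ≡ ((c * d) ·ₚ 1ₚ) n
      constant-product c d zero    = trans (ℤₚ.+-identityʳ _) (trans (cong₂ _*_ (ℤₚ.*-identityʳ c) (ℤₚ.*-identityʳ d))
                                                                     (sym (ℤₚ.*-identityʳ (c * d))))
      constant-product c d (suc n) = begin
        c * 1ℤ * (d * 0ℤ) + ∑< (suc n) (λ i → c * 0ℤ * (d ·ₚ 1ₚ) (n ∸ i))
          ≡⟨ cong₂ _+_ (cong (c * 1ℤ *_) (ℤₚ.*-zeroʳ d)) (∑-zero (suc n) (λ i _ → cong (_* (d ·ₚ 1ₚ) (n ∸ i)) (ℤₚ.*-zeroʳ c))) ⟩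
        c * 1ℤ * 0ℤ + 0ℤ
          ≡⟨ trans (ℤₚ.+-identityʳ _) (ℤₚ.*-zeroʳ (c * 1ℤ)) ⟩
        0ℤ
          ≡⟨ ℤₚ.*-zeroʳ (c * d) ⟨
        c * d * 0ℤ
          ∎

    constants-equal? : ∀ (c d : ℤ) → Maybe (c ·ₚ 1ₚ ≈ d ·ₚ 1ₚ)
    constants-equal? c d with c ℤ.≟ d
    ... | yes refl = just (coeffwise (λ _ → refl))
    ... | no _     = nothing

  open import Algebra.Solver.Ring ℤ.+-*-rawRing (fromCommutativeRing PS-commutativeRing) ℤ⟶PS constants-equal? public
    using (solve; _:=_; _:+_; _:*_; _:-_; con)

  δ-resp-⇔ : ∀ {a b c d} → (a ≡ b → c ≡ d) → (c ≡ d → a ≡ b) → δ a b ≡ δ c d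
  δ-resp-⇔ {a} {b} {c} {d} to from = cong (if_then 1ℤ else 0ℤ) (does-⇔ (mk⇔ to from) (a ≟ b) (c ≟ d))

  qⁿ-*ₚ-≤ : ∀ a g n → a ℕ.≤ n → (qⁿ a *ₚ g) n ≡ g (n ∸ a)
  qⁿ-*ₚ-≤ a g n a≤n = trans (*ₚ-unfold (qⁿ a) g n) (∑-δ (suc n) a (λ i → g (n ∸ i)) (s≤s a≤n))

  qⁿ-*ₚ-> : ∀ a g n → n ℕ.< a → (qⁿ a *ₚ g) n ≡ 0ℤ
  qⁿ-*ₚ-> a g n n<a = trans (*ₚ-unfold (qⁿ a) g n) (∑-δ-outside (suc n) a (λ i → g (n ∸ i)) n<a)

  qⁿ-+ : ∀ a b → qⁿ a *ₚ qⁿ b ≈ qⁿ (a ℕ.+ b)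
  qⁿ-+ a b = coeffwise coefficient
    where
    coefficient : ∀ n → (qⁿ a *ₚ qⁿ b) n ≡ qⁿ (a ℕ.+ b) n
    coefficient n with a ℕ.≤? n
    ... | yes a≤n = trans (qⁿ-*ₚ-≤ a (qⁿ b) n a≤n)
                          (δ-resp-⇔ (λ n∸a≡b → trans (sym (ℕₚ.m+[n∸m]≡n a≤n)) (cong (a ℕ.+_) n∸a≡b))
                                    (λ n≡a+b → trans (cong (_∸ a) n≡a+b) (ℕₚ.m+n∸m≡n a b)))
    ... | no a≰n  = trans (qⁿ-*ₚ-> a (qⁿ b) n (ℕₚ.≰⇒> a≰n))
                          (sym (δ-≢ (λ n≡a+b → a≰n (subst (a ℕ.≤_) (sym n≡a+b) (ℕₚ.m≤m+n a b)))))

  qⁿ-0 : qⁿ 0 ≈ 1ₚ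
  qⁿ-0 = coeffwise λ { zero → refl ; (suc n) → refl }

  qᶻ-+ : ∀ e → qᶻ (+ e) ≈ qⁿ e
  qᶻ-+ e = coeffwise λ n → cong (if_then 1ℤ else 0ℤ) (does-⇔ (mk⇔ ℤₚ.+-injective (cong (λ x → + x))) (+ n ℤ.≟ + e) (n ≟ e))

module QProducts where

  open import Defs
  open import Data.Nat as ℕ using (zero; suc; _∸_; z≤n; s≤s; _<_)
  import Data.Nat.Properties as ℕₚ
  open import Data.Nat.Divisibility using (divides; _∣?_; ∣m+n∣m⇒∣n; ∣m∣n⇒∣m+n; ∣-refl; ∣⇒≤)
  open import Data.Integer as ℤ using (0ℤ; 1ℤ; _-_; -_)
  import Data.Integer.Properties as ℤₚ
  open import Data.List using ([]; _∷_; _++_; upTo)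
  import Data.List.Properties as Listₚ
  open import Data.Bool using (true; false; if_then_else_)
  open import Data.Sum using (inj₁; inj₂)
  open import Relation.Nullary using (yes; no; does)
  open import Relation.Nullary.Decidable using (dec-true; dec-false; does-⇔)
  open import Function.Bundles using (mk⇔)
  import Relation.Binary.PropositionalEquality as ≡
  open ≡ using (_≡_)
  open import Data.Nat.Tactic.RingSolver using (solve-∀)
  open import Algebra.Bundles using (CommutativeRing)
  open PowerSeries
  open CommutativeRing PS-commutativeRing
    using (setoid; refl; sym; trans; reflexive; +-cong; *-cong; *-assoc; +-identityˡ; *-identityˡ; *-identityʳ; zeroʳ; distribʳ)
  open import Algebra.Properties.Ring (CommutativeRing.ring PS-commutativeRing) using (-‿distribˡ-*)
  open import Relation.Binary.Reasoning.Setoid setoid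

  Πₚ-++ : ∀ xs ys F → Πₚ (xs ++ ys) F ≈ Πₚ xs F *ₚ Πₚ ys F
  Πₚ-++ []       ys F = sym (*-identityˡ (Πₚ ys F))
  Πₚ-++ (x ∷ xs) ys F = trans (*-cong (refl {F x}) (Πₚ-++ xs ys F)) (sym (*-assoc (F x) (Πₚ xs F) (Πₚ ys F)))

  Πₚ-upTo-suc : ∀ j F → Πₚ (upTo (suc j)) F ≈ Πₚ (upTo j) F *ₚ F j
  Πₚ-upTo-suc j F = trans (reflexive (≡.cong (λ xs → Πₚ xs F) (≡.sym (Listₚ.upTo-∷ʳ j))))
                          (trans (Πₚ-++ (upTo j) (j ∷ []) F) (*-cong (refl {Πₚ (upTo j) F}) (*-identityʳ (F j))))

  1-qⁿ : ℕ → PS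
  1-qⁿ e = 1ₚ +ₚ negₚ (qⁿ e)

  1-1·qⁿ : ∀ e → 1ₚ -ₚ 1ℤ ·ₚ qⁿ e ≈ 1-qⁿ e
  1-1·qⁿ e = coeffwise λ n → ≡.cong (λ x → 1ₚ n - x) (ℤₚ.*-identityˡ (qⁿ e n))

  1-qⁿ-split : ∀ a b → 1-qⁿ a +ₚ qⁿ a *ₚ 1-qⁿ b ≈ 1-qⁿ (a ℕ.+ b)
  1-qⁿ-split a b = begin
    (1ₚ +ₚ negₚ (qⁿ a)) +ₚ qⁿ a *ₚ (1ₚ +ₚ negₚ (qⁿ b))
      ≈⟨ +-cong (+-cong one refl) (*-cong (refl {qⁿ a}) (+-cong one refl)) ⟨
    (one′ +ₚ negₚ (qⁿ a)) +ₚ qⁿ a *ₚ (one′ +ₚ negₚ (qⁿ b))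
      ≈⟨ solve 2 (λ x y → (con 1ℤ :- x) :+ x :* (con 1ℤ :- y) := con 1ℤ :- x :* y) refl (qⁿ a) (qⁿ b) ⟩
    one′ +ₚ negₚ (qⁿ a *ₚ qⁿ b)
      ≈⟨ +-cong one (coeffwise λ n → ≡.cong -_ (coeff (qⁿ-+ a b) n)) ⟩
    1ₚ +ₚ negₚ (qⁿ (a ℕ.+ b))
      ∎
    where
    -- the solver's constant 1
    one′ : PS
    one′ = 1ℤ ·ₚ 1ₚ
    one : one′ ≈ 1ₚ
    one = coeffwise λ n → ℤₚ.*-identityˡ (1ₚ n)

  1-qⁿ-*ₚ : ∀ e g → 1-qⁿ e *ₚ g ≈ g +ₚ negₚ (qⁿ e *ₚ g)
  1-qⁿ-*ₚ e g = begin
    (1ₚ +ₚ negₚ (qⁿ e)) *ₚ g          ≈⟨ distribʳ g 1ₚ (negₚ (qⁿ e)) ⟩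
    1ₚ *ₚ g +ₚ negₚ (qⁿ e) *ₚ g       ≈⟨ +-cong (*-identityˡ g) (sym (-‿distribˡ-* (qⁿ e) g)) ⟩
    g +ₚ negₚ (qⁿ e *ₚ g)             ∎

  geomInv-coeff : ∀ f n → geomInv 1ℤ f n ≡ (if does (suc f ∣? n) then 1ℤ else 0ℤ)
  geomInv-coeff f n with does (suc f ∣? n)
  ... | true  = ℤₚ.^-zeroˡ (n ℕ./ suc f)
  ... | false = ≡.refl

  geomInv-0 : ∀ f → geomInv 1ℤ f 0 ≡ 1ℤ
  geomInv-0 f = ≡.trans (geomInv-coeff f 0) (≡.cong (if_then 1ℤ else 0ℤ) (dec-true (suc f ∣? 0) (divides 0 ≡.refl)))

  geomInv-< : ∀ f n → suc n < suc f → geomInv 1ℤ f (suc n) ≡ 0ℤ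
  geomInv-< f n n<f = ≡.trans (geomInv-coeff f (suc n))
    (≡.cong (if_then 1ℤ else 0ℤ) (dec-false (suc f ∣? suc n) (λ f∣n → ℕₚ.<⇒≱ n<f (∣⇒≤ f∣n))))

  geomInv-periodic : ∀ f m → geomInv 1ℤ f (suc f ℕ.+ m) ≡ geomInv 1ℤ f m
  geomInv-periodic f m = ≡.trans (geomInv-coeff f (suc f ℕ.+ m)) (≡.trans
    (≡.cong (if_then 1ℤ else 0ℤ)
            (does-⇔ (mk⇔ (λ f∣f+m → ∣m+n∣m⇒∣n f∣f+m ∣-refl) (∣m∣n⇒∣m+n ∣-refl)) (suc f ∣? suc f ℕ.+ m) (suc f ∣? m)))
    (≡.sym (geomInv-coeff f m)))

  geomInv-inverse : ∀ f → 1-qⁿ (suc f) *ₚ geomInv 1ℤ f ≈ 1ₚ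
  geomInv-inverse f = trans (1-qⁿ-*ₚ (suc f) γ) (coeffwise coefficient)
    where
    γ : PS
    γ = geomInv 1ℤ f
    coefficient : ∀ n → γ n - (qⁿ (suc f) *ₚ γ) n ≡ 1ₚ n
    coefficient zero = ≡.cong₂ _-_ (geomInv-0 f) (qⁿ-*ₚ-> (suc f) γ 0 (s≤s z≤n))
    coefficient (suc n) with suc f ℕ.≤? suc n
    ... | yes f≤n = ≡.trans (≡.cong₂ _-_ (≡.trans (≡.cong γ (≡.sym (ℕₚ.m+[n∸m]≡n f≤n))) (geomInv-periodic f (suc n ∸ suc f)))
                                        (qⁿ-*ₚ-≤ (suc f) γ (suc n) f≤n))
                            (ℤₚ.+-inverseʳ (γ (suc n ∸ suc f)))
    ... | no f≰n  = ≡.cong₂ _-_ (geomInv-< f n (ℕₚ.≰⇒> f≰n)) (qⁿ-*ₚ-> (suc f) γ (suc n) (ℕₚ.≰⇒> f≰n))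

  q2q2-suc : ∀ t → q2q2 (suc t) ≈ q2q2 t *ₚ 1-qⁿ (2 ℕ.+ 2 ℕ.* t)
  q2q2-suc t = trans (Πₚ-upTo-suc t (λ i → 1ₚ -ₚ 1ℤ ·ₚ qⁿ (2 ℕ.+ 2 ℕ.* i))) (*-cong (refl {q2q2 t}) (1-1·qⁿ (2 ℕ.+ 2 ℕ.* t)))

  q2q2-inverse : ∀ j → q2q2 j *ₚ q2q2Inv j ≈ 1ₚ
  q2q2-inverse zero    = *-identityˡ 1ₚ
  q2q2-inverse (suc j) = begin
    q2q2 (suc j) *ₚ q2q2Inv (suc j)                              ≈⟨ *-cong (q2q2-suc j) (Πₚ-upTo-suc j γ) ⟩
    (q2q2 j *ₚ 1-qⁿ (2 ℕ.+ 2 ℕ.* j)) *ₚ (q2q2Inv j *ₚ γ j)        ≈⟨ solve 4 (λ a b c d → (a :* b) :* (c :* d) := (a :* c) :* (b :* d))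
                                                                          refl (q2q2 j) (1-qⁿ (2 ℕ.+ 2 ℕ.* j)) (q2q2Inv j) (γ j) ⟩
    (q2q2 j *ₚ q2q2Inv j) *ₚ (1-qⁿ (2 ℕ.+ 2 ℕ.* j) *ₚ γ j)        ≈⟨ *-cong (q2q2-inverse j) (geomInv-inverse (1 ℕ.+ 2 ℕ.* j)) ⟩
    1ₚ *ₚ 1ₚ                                                     ≈⟨ *-identityˡ 1ₚ ⟩
    1ₚ                                                           ∎
    where
    γ : ℕ → PS
    γ t = geomInv 1ℤ (1 ℕ.+ 2 ℕ.* t)

  qbinomial : ℕ → ℕ → PS
  qbinomial N       zero    = 1ₚ
  qbinomial zero    (suc L) = 0ₚ
  qbinomial (suc N) (suc L) = qbinomial N (suc L) +ₚ qⁿ (2 ℕ.* (N ∸ L)) *ₚ qbinomial N L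

  qbinomial-> : ∀ N L → N < L → qbinomial N L ≈ 0ₚ
  qbinomial-> zero    (suc L) _         = refl
  qbinomial-> (suc N) (suc L) (s≤s N<L) = begin
    qbinomial N (suc L) +ₚ qⁿ (2 ℕ.* (N ∸ L)) *ₚ qbinomial N L
      ≈⟨ +-cong (qbinomial-> N (suc L) (ℕₚ.m<n⇒m<1+n N<L)) (*-cong (refl {qⁿ (2 ℕ.* (N ∸ L))}) (qbinomial-> N L N<L)) ⟩
    0ₚ +ₚ qⁿ (2 ℕ.* (N ∸ L)) *ₚ 0ₚ
      ≈⟨ trans (+-identityˡ _) (zeroʳ (qⁿ (2 ℕ.* (N ∸ L)))) ⟩
    0ₚ
      ∎

  private
    φ : ℕ → PS
    φ t = 1-qⁿ (2 ℕ.+ 2 ℕ.* t)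

  qbinomial-product-diagonal : ∀ L → qbinomial L L *ₚ (q2q2 L *ₚ q2q2 (L ∸ L)) ≈ q2q2 L →
                               qbinomial (suc L) (suc L) *ₚ (q2q2 (suc L) *ₚ q2q2 (L ∸ L)) ≈ q2q2 (suc L)
  qbinomial-product-diagonal L IH = begin
    (qbinomial L (suc L) +ₚ qⁿ (2 ℕ.* (L ∸ L)) *ₚ B) *ₚ (q2q2 (suc L) *ₚ q2q2 (L ∸ L))
      ≈⟨ *-cong (+-cong (qbinomial-> L (suc L) ℕₚ.≤-refl) (*-cong q⁰ (refl {B}))) (*-cong (q2q2-suc L) (reflexive (≡.cong q2q2 L∸L≡0))) ⟩
    (0ₚ +ₚ 1ₚ *ₚ B) *ₚ ((A *ₚ φ L) *ₚ 1ₚ)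
      ≈⟨ *-cong (trans (+-identityˡ _) (*-identityˡ B)) (refl {(A *ₚ φ L) *ₚ 1ₚ}) ⟩
    B *ₚ ((A *ₚ φ L) *ₚ 1ₚ)
      ≈⟨ solve 4 (λ b a f o → b :* ((a :* f) :* o) := (b :* (a :* o)) :* f) refl B A (φ L) 1ₚ ⟩
    (B *ₚ (A *ₚ 1ₚ)) *ₚ φ L
      ≈⟨ *-cong (trans (*-cong (refl {B}) (*-cong (refl {A}) (reflexive (≡.cong q2q2 (≡.sym L∸L≡0))))) IH) (refl {φ L}) ⟩
    A *ₚ φ L
      ≈⟨ q2q2-suc L ⟨
    q2q2 (suc L)
      ∎
    where
    A B : PS
    A = q2q2 L
    B = qbinomial L L
    L∸L≡0 : L ∸ L ≡ 0
    L∸L≡0 = ℕₚ.n∸n≡0 L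
    q⁰ : qⁿ (2 ℕ.* (L ∸ L)) ≈ 1ₚ
    q⁰ = trans (reflexive (≡.cong (λ t → qⁿ (2 ℕ.* t)) L∸L≡0)) qⁿ-0

  qbinomial-product-step : ∀ N L → L < N →
    qbinomial N (suc L) *ₚ (q2q2 (suc L) *ₚ q2q2 (N ∸ suc L)) ≈ q2q2 N →
    qbinomial N L *ₚ (q2q2 L *ₚ q2q2 (N ∸ L)) ≈ q2q2 N →
    qbinomial (suc N) (suc L) *ₚ (q2q2 (suc L) *ₚ q2q2 (N ∸ L)) ≈ q2q2 (suc N)
  qbinomial-product-step N L L<N IH₁ IH₀ = begin
    (B₁ +ₚ qⁿ (2 ℕ.* (N ∸ L)) *ₚ B₀) *ₚ (q2q2 (suc L) *ₚ q2q2 (N ∸ L))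
      ≈⟨ *-cong (+-cong (refl {B₁}) (*-cong (reflexive (≡.cong qⁿ 2[N∸L])) (refl {B₀})))
                (*-cong (q2q2-suc L) (trans (reflexive (≡.cong q2q2 N∸L≡1+d)) (q2q2-suc d))) ⟩
    (B₁ +ₚ Q *ₚ B₀) *ₚ ((A *ₚ φ L) *ₚ (D *ₚ φ d))
      ≈⟨ solve 7 (λ b₁ b₀ q a d f g → (b₁ :+ q :* b₀) :* ((a :* f) :* (d :* g))
                                       := (b₁ :* ((a :* f) :* d)) :* g :+ q :* (b₀ :* (a :* (d :* g))) :* f)
                 refl B₁ B₀ Q A D (φ L) (φ d) ⟩
    (B₁ *ₚ ((A *ₚ φ L) *ₚ D)) *ₚ φ d +ₚ Q *ₚ (B₀ *ₚ (A *ₚ (D *ₚ φ d))) *ₚ φ L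
      ≈⟨ +-cong (*-cong IH₁′ (refl {φ d})) (*-cong (*-cong (refl {Q}) IH₀′) (refl {φ L})) ⟩
    W *ₚ φ d +ₚ Q *ₚ W *ₚ φ L
      ≈⟨ solve 4 (λ w g q f → w :* g :+ q :* w :* f := w :* (g :+ q :* f)) refl W (φ d) Q (φ L) ⟩
    W *ₚ (φ d +ₚ Q *ₚ φ L)
      ≈⟨ *-cong (refl {W}) (trans (1-qⁿ-split (2 ℕ.+ 2 ℕ.* d) (2 ℕ.+ 2 ℕ.* L)) (reflexive (≡.cong 1-qⁿ exponents))) ⟩
    W *ₚ φ N
      ≈⟨ q2q2-suc N ⟨
    q2q2 (suc N)
      ∎
    where
    d : ℕ
    d = N ∸ suc L
    A D W Q B₁ B₀ : PS
    A = q2q2 L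
    D = q2q2 d
    W = q2q2 N
    Q = qⁿ (2 ℕ.+ 2 ℕ.* d)
    B₁ = qbinomial N (suc L)
    B₀ = qbinomial N L
    N∸L≡1+d : N ∸ L ≡ suc d
    N∸L≡1+d = ℕₚ.+-∸-assoc 1 L<N
    2[N∸L] : 2 ℕ.* (N ∸ L) ≡ 2 ℕ.+ 2 ℕ.* d
    2[N∸L] = ≡.trans (≡.cong (2 ℕ.*_) N∸L≡1+d) (ℕₚ.*-suc 2 d)
    exponents : (2 ℕ.+ 2 ℕ.* d) ℕ.+ (2 ℕ.+ 2 ℕ.* L) ≡ 2 ℕ.+ 2 ℕ.* N
    exponents = ≡.trans (regroup d L) (≡.cong (λ t → 2 ℕ.+ 2 ℕ.* t) (ℕₚ.m+[n∸m]≡n L<N))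
      where
      regroup : ∀ d L → (2 ℕ.+ 2 ℕ.* d) ℕ.+ (2 ℕ.+ 2 ℕ.* L) ≡ 2 ℕ.+ 2 ℕ.* (suc L ℕ.+ d)
      regroup = solve-∀
    IH₁′ : B₁ *ₚ ((A *ₚ φ L) *ₚ D) ≈ W
    IH₁′ = trans (*-cong (refl {B₁}) (*-cong (sym (q2q2-suc L)) (refl {D}))) IH₁
    IH₀′ : B₀ *ₚ (A *ₚ (D *ₚ φ d)) ≈ W
    IH₀′ = trans (*-cong (refl {B₀}) (*-cong (refl {A}) (trans (sym (q2q2-suc d)) (reflexive (≡.cong q2q2 (≡.sym N∸L≡1+d)))))) IH₀

  qbinomial-product : ∀ N L → L ℕ.≤ N → qbinomial N L *ₚ (q2q2 L *ₚ q2q2 (N ∸ L)) ≈ q2q2 N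
  qbinomial-product N       zero    _         = trans (*-identityˡ _) (*-identityˡ (q2q2 N))
  qbinomial-product (suc N) (suc L) (s≤s L≤N) with ℕₚ.m≤n⇒m<n∨m≡n L≤N
  ... | inj₂ ≡.refl = qbinomial-product-diagonal L (qbinomial-product L L ℕₚ.≤-refl)
  ... | inj₁ L<N    = qbinomial-product-step N L L<N (qbinomial-product N (suc L) L<N) (qbinomial-product N L (ℕₚ.<⇒≤ L<N))

  gaussN≈qbinomial : ∀ N L → gaussN N L ≈ qbinomial N L
  gaussN≈qbinomial N L with L ℕ.≤? N
  ... | yes L≤N = begin
    q2q2 N *ₚ q2q2Inv L *ₚ q2q2Inv (N ∸ L)
      ≈⟨ *-cong (*-cong (sym (qbinomial-product N L L≤N)) (refl {q2q2Inv L})) (refl {q2q2Inv (N ∸ L)}) ⟩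
    B *ₚ (q2q2 L *ₚ q2q2 (N ∸ L)) *ₚ q2q2Inv L *ₚ q2q2Inv (N ∸ L)
      ≈⟨ solve 5 (λ b a d a′ d′ → b :* (a :* d) :* a′ :* d′ := b :* (a :* a′) :* (d :* d′))
               refl B (q2q2 L) (q2q2 (N ∸ L)) (q2q2Inv L) (q2q2Inv (N ∸ L)) ⟩
    B *ₚ (q2q2 L *ₚ q2q2Inv L) *ₚ (q2q2 (N ∸ L) *ₚ q2q2Inv (N ∸ L))
      ≈⟨ *-cong (*-cong (refl {B}) (q2q2-inverse L)) (q2q2-inverse (N ∸ L)) ⟩
    B *ₚ 1ₚ *ₚ 1ₚ
      ≈⟨ trans (*-identityʳ _) (*-identityʳ B) ⟩
    B
      ∎
    where
    B : PS
    B = qbinomial N L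
  ... | no L≰N  = sym (qbinomial-> N L (ℕₚ.≰⇒> L≰N))

module Classes where

  open import Defs
  open import Data.Nat using (zero; suc; _∸_; z≤n; s≤s; _<_; _+_; _*_; _≟_)
  import Data.Nat.Properties as ℕₚ
  open import Data.Nat.Tactic.RingSolver using (solve-∀)
  open import Data.Nat.Divisibility using (divides; _∣?_)
  open import Data.Integer as ℤ using (+_; 0ℤ; 1ℤ)
  import Data.Integer.Properties as ℤₚ
  open import Data.Fin using (Fin)
  import Data.Fin.Properties as Finₚ
  open import Data.Product using (_×_; _,_; proj₁; proj₂)
  open import Data.Product.Function.NonDependent.Propositional using (_×-↔_)
  open import Data.Product.Function.Dependent.Propositional using (Σ-↔)
  open import Data.Sum using (_⊎_; inj₁; inj₂)
  open import Data.Sum.Function.Propositional using (_⊎-↔_)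
  open import Data.Unit using (⊤; tt)
  open import Data.Empty using (⊥; ⊥-elim)
  open import Data.List using (filter; applyUpTo)
  open import Data.Bool using (if_then_else_)
  open import Function using (_∘_)
  open import Function.Bundles using (_↔_; Inverse; mk↔ₛ′)
  open import Function.Properties.Inverse using (↔-refl; ↔-sym; ↔-trans)
  open import Relation.Nullary using (yes; no; ¬_)
  open import Relation.Nullary.Decidable using (dec-true; dec-false)
  open import Relation.Unary using (Decidable)
  open import Relation.Binary.PropositionalEquality
  open PowerSeries using (∑<; ∑-cong; *ₚ-unfold; _≈_; coeff)
  open QProducts using (geomInv-coeff)
  open Inverse using (to; from; strictlyInverseˡ; strictlyInverseʳ)

  record Class : Set₁ where
    constructor class
    field
      Obj  : Set
      size : Obj → ℕ
  open Class public

  infix 5 _of-size_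
  _of-size_ : Class → ℕ → Set
  C of-size n = Σ (Obj C) λ x → size C x ≡ n

  infix 4 _counts_
  _counts_ : PS → Class → Set
  f counts C = ∀ n → Σ ℕ λ c → f n ≡ + c × (Fin c ↔ C of-size n)

  infix 4 _≅_
  record _≅_ (C D : Class) : Set where
    constructor mk≅
    field
      bijection       : Obj C ↔ Obj D
      size-preserving : ∀ x → size D (to bijection x) ≡ size C x
  open _≅_ public

  ≅-refl : ∀ {C} → C ≅ C
  ≅-refl = mk≅ ↔-refl (λ _ → refl)

  ≅-sym : ∀ {C D} → C ≅ D → D ≅ C
  ≅-sym {C} {D} (mk≅ φ pres) = mk≅ (↔-sym φ) (λ y → trans (sym (pres (from φ y))) (cong (size D) (strictlyInverseˡ φ y)))

  ≅-trans : ∀ {C D E} → C ≅ D → D ≅ E → C ≅ E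
  ≅-trans (mk≅ φ pres) (mk≅ ψ pres′) = mk≅ (↔-trans φ ψ) (λ x → trans (pres′ (to φ x)) (pres x))

  ≡⇒≅ : ∀ {C D} → C ≡ D → C ≅ D
  ≡⇒≅ refl = ≅-refl

  of-size-≡ : ∀ {C n} {x y : Obj C} (p : size C x ≡ n) (q : size C y ≡ n) → x ≡ y → _≡_ {A = C of-size n} (x , p) (y , q)
  of-size-≡ p q refl = cong (_ ,_) (ℕₚ.≡-irrelevant p q)

  of-size-cong : ∀ {C D} → C ≅ D → ∀ n → C of-size n ↔ D of-size n
  of-size-cong {C} {D} (mk≅ φ pres) n = mk↔ₛ′
    (λ (x , p) → to φ x , trans (pres x) p)
    (λ (y , q) → from φ y , trans (sym (pres (from φ y))) (trans (cong (size D) (strictlyInverseˡ φ y)) q))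
    (λ (y , q) → of-size-≡ {D} _ q (strictlyInverseˡ φ y))
    (λ (x , p) → of-size-≡ {C} _ p (strictlyInverseʳ φ x))

  counts-≅ : ∀ {f C D} → f counts C → C ≅ D → f counts D
  counts-≅ f-counts C≅D n = let c , fₙ≡c , count = f-counts n in c , fₙ≡c , ↔-trans count (of-size-cong C≅D n)

  counts-≈ : ∀ {f g C} → f ≈ g → f counts C → g counts C
  counts-≈ f≈g f-counts n = let c , fₙ≡c , count = f-counts n in c , trans (sym (coeff f≈g n)) fₙ≡c , count

  ∅ : Class
  ∅ = class ⊥ λ ()

  pt : ℕ → Class
  pt e = class ⊤ λ _ → e

  infixr 6 _⊕_
  infixr 7 _⊗_

  _⊕_ : Class → Class → Class
  C ⊕ D = class (Obj C ⊎ Obj D) λ { (inj₁ x) → size C x ; (inj₂ y) → size D y }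

  _⊗_ : Class → Class → Class
  C ⊗ D = class (Obj C × Obj D) λ (x , y) → size C x + size D y

  multiples : ℕ → Class
  multiples f = class ℕ λ d → suc f * d

  guard : Set → Class → Class
  guard P C = class (P × Obj C) λ (_ , x) → size C x

  Bounded : ℕ → (ℕ → Set) → Set
  Bounded N P = Σ ℕ λ i → i < N × P i

  Bounded-suc : ∀ N (P : ℕ → Set) → (P 0 ⊎ Bounded N (P ∘ suc)) ↔ Bounded (suc N) P
  Bounded-suc N P = mk↔ₛ′ to′ from′ to∘from from∘to
    where
    to′ : P 0 ⊎ Bounded N (P ∘ suc) → Bounded (suc N) P
    to′ (inj₁ p)             = 0 , s≤s z≤n , p
    to′ (inj₂ (i , i<N , p)) = suc i , s≤s i<N , p
    from′ : Bounded (suc N) P → P 0 ⊎ Bounded N (P ∘ suc)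
    from′ (zero  , _         , p) = inj₁ p
    from′ (suc i , s≤s i<N , p) = inj₂ (i , i<N , p)
    to∘from : ∀ x → to′ (from′ x) ≡ x
    to∘from (zero  , s≤s z≤n , p) = refl
    to∘from (suc i , s≤s i<N , p) = refl
    from∘to : ∀ x → from′ (to′ x) ≡ x
    from∘to (inj₁ p) = refl
    from∘to (inj₂ _) = refl

  ⨁< : ℕ → (ℕ → Class) → Class
  ⨁< N D = class (Bounded N (Obj ∘ D)) λ (i , _ , x) → size (D i) x

  private
    empty-count : ∀ {A : Set} → ¬ A → Fin 0 ↔ A
    empty-count ¬a = mk↔ₛ′ (λ ()) (λ a → ⊥-elim (¬a a)) (λ a → ⊥-elim (¬a a)) (λ ())

    single-count : ∀ {A : Set} (a : A) → (∀ b → b ≡ a) → Fin 1 ↔ A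
    single-count a unique = ↔-trans Finₚ.1↔⊤ (mk↔ₛ′ (λ _ → a) (λ _ → tt) (λ b → sym (unique b)) (λ _ → refl))

  counts-∅ : 0ₚ counts ∅
  counts-∅ n = 0 , refl , empty-count (λ ())

  counts-pt : ∀ e → qⁿ e counts pt e
  counts-pt e n with n ≟ e
  ... | yes refl = 1 , cong (if_then 1ℤ else 0ℤ) (dec-true (n ≟ n) refl) , single-count (tt , refl) (λ (tt , p) → of-size-≡ {pt e} p refl refl)
  ... | no n≢e   = 0 , cong (if_then 1ℤ else 0ℤ) (dec-false (n ≟ e) n≢e) , empty-count (λ (_ , e≡n) → n≢e (sym e≡n))

  counts-1 : 1ₚ counts pt 0
  counts-1 = counts-≈ PowerSeries.qⁿ-0 (counts-pt 0)

  counts-multiples : ∀ f → geomInv 1ℤ f counts multiples f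
  counts-multiples f n with suc f ∣? n
  ... | yes (divides d n≡d*f) = 1 , trans (geomInv-coeff f n) (cong (if_then 1ℤ else 0ℤ) (dec-true (suc f ∣? n) (divides d n≡d*f)))
                              , single-count (d , d-works) (λ (d′ , p) → of-size-≡ {multiples f} p d-works (unique d′ p))
    where
    d-works : suc f * d ≡ n
    d-works = trans (ℕₚ.*-comm (suc f) d) (sym n≡d*f)
    unique : ∀ d′ → suc f * d′ ≡ n → d′ ≡ d
    unique d′ p = ℕₚ.*-cancelˡ-≡ d′ d (suc f) (trans p (sym d-works))
  ... | no f∤n = 0 , trans (geomInv-coeff f n) (cong (if_then 1ℤ else 0ℤ) (dec-false (suc f ∣? n) f∤n))
               , empty-count (λ (d , p) → f∤n (divides d (trans (sym p) (ℕₚ.*-comm (suc f) d))))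

  ∑ℕ< : ℕ → (ℕ → ℕ) → ℕ
  ∑ℕ< zero    F = 0
  ∑ℕ< (suc n) F = F 0 + ∑ℕ< n (F ∘ suc)

  ∑<-+ : ∀ n F → ∑< n (λ i → + F i) ≡ + ∑ℕ< n F
  ∑<-+ zero    F = refl
  ∑<-+ (suc n) F = cong (λ s → + F 0 ℤ.+ s) (∑<-+ n (F ∘ suc))

  Fin-∑ℕ< : ∀ n F → Fin (∑ℕ< n F) ↔ Bounded n (Fin ∘ F)
  Fin-∑ℕ< zero    F = mk↔ₛ′ (λ ()) (λ ()) (λ ()) (λ ())
  Fin-∑ℕ< (suc n) F = ↔-trans Finₚ.+↔⊎ (↔-trans (↔-refl ⊎-↔ Fin-∑ℕ< n (F ∘ suc)) (Bounded-suc n (Fin ∘ F)))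

  ⊕-of-size : ∀ C D n → (C of-size n ⊎ D of-size n) ↔ (C ⊕ D) of-size n
  ⊕-of-size C D n = mk↔ₛ′ to′ from′ to∘from from∘to
    where
    to′ : C of-size n ⊎ D of-size n → (C ⊕ D) of-size n
    to′ (inj₁ (x , p)) = inj₁ x , p
    to′ (inj₂ (y , p)) = inj₂ y , p
    from′ : (C ⊕ D) of-size n → C of-size n ⊎ D of-size n
    from′ (inj₁ x , p) = inj₁ (x , p)
    from′ (inj₂ y , p) = inj₂ (y , p)
    to∘from : ∀ z → to′ (from′ z) ≡ z
    to∘from (inj₁ _ , _) = refl
    to∘from (inj₂ _ , _) = refl
    from∘to : ∀ z → from′ (to′ z) ≡ z
    from∘to (inj₁ _) = refl
    from∘to (inj₂ _) = refl

  ⊗-of-size : ∀ C D n → Bounded (suc n) (λ i → C of-size i × D of-size (n ∸ i)) ↔ (C ⊗ D) of-size n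
  ⊗-of-size C D n = mk↔ₛ′ to′ from′ to∘from from∘to
    where
    to′ : Bounded (suc n) (λ i → C of-size i × D of-size (n ∸ i)) → (C ⊗ D) of-size n
    to′ (i , s≤s i≤n , (x , refl) , (y , q)) = (x , y) , trans (cong (_+_ (size C x)) q) (ℕₚ.m+[n∸m]≡n i≤n)
    from′ : (C ⊗ D) of-size n → Bounded (suc n) (λ i → C of-size i × D of-size (n ∸ i))
    from′ ((x , y) , p) = size C x , s≤s (ℕₚ.≤-trans (ℕₚ.m≤m+n (size C x) (size D y)) (ℕₚ.≤-reflexive p)) , (x , refl)
                        , (y , trans (sym (ℕₚ.m+n∸m≡n (size C x) (size D y))) (cong (_∸ size C x) p))
    to∘from : ∀ z → to′ (from′ z) ≡ z
    to∘from ((x , y) , p) = of-size-≡ {C ⊗ D} _ p refl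
    from∘to : ∀ z → from′ (to′ z) ≡ z
    from∘to (i , s≤s i≤n , (x , refl) , (y , q)) =
      cong₂ (λ i<n q → i , i<n , (x , refl) , (y , q)) (ℕₚ.≤-irrelevant _ _) (ℕₚ.≡-irrelevant _ _)

  counts-+ : ∀ {f g C D} → f counts C → g counts D → f +ₚ g counts C ⊕ D
  counts-+ {C = C} {D} f-counts g-counts n =
    let a , fₙ≡a , A = f-counts n
        b , gₙ≡b , B = g-counts n
    in a + b , cong₂ ℤ._+_ fₙ≡a gₙ≡b , ↔-trans Finₚ.+↔⊎ (↔-trans (A ⊎-↔ B) (⊕-of-size C D n))

  counts-* : ∀ {f g C D} → f counts C → g counts D → f *ₚ g counts C ⊗ D
  counts-* {f} {g} {C} {D} f-counts g-counts n = ∑ℕ< (suc n) G , coefficient ,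
    ↔-trans (Fin-∑ℕ< (suc n) G)
      (↔-trans (Σ-↔ ↔-refl (λ {i} → ↔-refl ×-↔ ↔-trans Finₚ.*↔× (count i ×-↔ count′ (n ∸ i)))) (⊗-of-size C D n))
    where
    a b G : ℕ → ℕ
    a i = proj₁ (f-counts i)
    b j = proj₁ (g-counts j)
    G i = a i * b (n ∸ i)
    count : ∀ i → Fin (a i) ↔ C of-size i
    count i = proj₂ (proj₂ (f-counts i))
    count′ : ∀ j → Fin (b j) ↔ D of-size j
    count′ j = proj₂ (proj₂ (g-counts j))
    coefficient : (f *ₚ g) n ≡ + ∑ℕ< (suc n) G
    coefficient = trans (*ₚ-unfold f g n) (trans (∑-cong (suc n) (λ i _ →
        trans (cong₂ ℤ._*_ (proj₁ (proj₂ (f-counts i))) (proj₁ (proj₂ (g-counts (n ∸ i))))) (sym (ℤₚ.pos-* (a i) (b (n ∸ i))))))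
      (∑<-+ (suc n) G))

  ⊕-cong : ∀ {A B C D} → A ≅ C → B ≅ D → A ⊕ B ≅ C ⊕ D
  ⊕-cong {A} {B} {C} {D} (mk≅ φ φ-size) (mk≅ ψ ψ-size) = mk≅ (mk↔ₛ′ to′ from′ to∘from from∘to) size′
    where
    to′ : Obj A ⊎ Obj B → Obj C ⊎ Obj D
    to′ (inj₁ x) = inj₁ (to φ x)
    to′ (inj₂ y) = inj₂ (to ψ y)
    from′ : Obj C ⊎ Obj D → Obj A ⊎ Obj B
    from′ (inj₁ x) = inj₁ (from φ x)
    from′ (inj₂ y) = inj₂ (from ψ y)
    to∘from : ∀ z → to′ (from′ z) ≡ z
    to∘from (inj₁ x) = cong inj₁ (strictlyInverseˡ φ x)
    to∘from (inj₂ y) = cong inj₂ (strictlyInverseˡ ψ y)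
    from∘to : ∀ z → from′ (to′ z) ≡ z
    from∘to (inj₁ x) = cong inj₁ (strictlyInverseʳ φ x)
    from∘to (inj₂ y) = cong inj₂ (strictlyInverseʳ ψ y)
    size′ : ∀ z → size (C ⊕ D) (to′ z) ≡ size (A ⊕ B) z
    size′ (inj₁ x) = φ-size x
    size′ (inj₂ y) = ψ-size y

  ⊗-cong : ∀ {A B C D} → A ≅ C → B ≅ D → A ⊗ B ≅ C ⊗ D
  ⊗-cong (mk≅ φ φ-size) (mk≅ ψ ψ-size) = mk≅
    (mk↔ₛ′ (λ (x , y) → to φ x , to ψ y) (λ (x , y) → from φ x , from ψ y)
           (λ (x , y) → cong₂ _,_ (strictlyInverseˡ φ x) (strictlyInverseˡ ψ y))
           (λ (x , y) → cong₂ _,_ (strictlyInverseʳ φ x) (strictlyInverseʳ ψ y)))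
    (λ (x , y) → cong₂ _+_ (φ-size x) (ψ-size y))

  ⨁<-suc : ∀ N D → D 0 ⊕ ⨁< N (D ∘ suc) ≅ ⨁< (suc N) D
  ⨁<-suc N D = mk≅ (Bounded-suc N (Obj ∘ D)) λ { (inj₁ _) → refl ; (inj₂ _) → refl }

  ∅-⊕ : ∀ {C} → C ≅ ∅ ⊕ C
  ∅-⊕ = mk≅ (mk↔ₛ′ inj₂ (λ { (inj₁ ()) ; (inj₂ x) → x }) (λ { (inj₁ ()) ; (inj₂ _) → refl }) (λ _ → refl)) (λ _ → refl)

  guard-yes : ∀ {P : Set} {C} → P → (∀ (p q : P) → p ≡ q) → C ≅ guard P C
  guard-yes p P-irrelevant = mk≅ (mk↔ₛ′ (p ,_) proj₂ (λ (q , x) → cong (_, x) (P-irrelevant p q)) (λ _ → refl)) (λ _ → refl)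

  guard-no : ∀ {P : Set} {C} → ¬ P → ∅ ≅ guard P C
  guard-no ¬p = mk≅ (mk↔ₛ′ (λ ()) (λ (p , _) → ⊥-elim (¬p p)) (λ (p , _) → ⊥-elim (¬p p)) (λ ())) (λ ())

  ⊗-distribˡ-⊕ : ∀ {a C D} → pt a ⊗ (C ⊕ D) ≅ (pt a ⊗ C) ⊕ (pt a ⊗ D)
  ⊗-distribˡ-⊕ = mk≅
    (mk↔ₛ′ (λ { (t , inj₁ x) → inj₁ (t , x) ; (t , inj₂ y) → inj₂ (t , y) })
           (λ { (inj₁ (t , x)) → t , inj₁ x ; (inj₂ (t , y)) → t , inj₂ y })
           (λ { (inj₁ _) → refl ; (inj₂ _) → refl })
           (λ { (_ , inj₁ _) → refl ; (_ , inj₂ _) → refl }))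
    (λ { (_ , inj₁ _) → refl ; (_ , inj₂ _) → refl })

  pt-merge : ∀ {a b c C D} → a + b ≡ c → pt a ⊗ (C ⊗ (pt b ⊗ D)) ≅ pt c ⊗ (C ⊗ D)
  pt-merge {a} {b} {c} {C} {D} a+b≡c = mk≅
    (mk↔ₛ′ (λ (_ , x , _ , y) → tt , x , y) (λ (_ , x , y) → tt , x , tt , y) (λ _ → refl) (λ _ → refl))
    (λ (_ , x , _ , y) → trans (cong (_+ (size C x + size D y)) (sym a+b≡c)) (regroup a b (size C x) (size D y)))
    where
    regroup : ∀ a b m n → a + b + (m + n) ≡ a + (m + (b + n))
    regroup = solve-∀

  subtype-≡ : ∀ {A : Set} {P : A → Set} → (∀ {a} (p q : P a) → p ≡ q) →
              ∀ {a b} {p : P a} {q : P b} → a ≡ b → _≡_ {A = Σ A P} (a , p) (b , q)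
  subtype-≡ P-irrelevant {p = p} {q} refl = cong (_ ,_) (P-irrelevant p q)

  ×-irrelevant : ∀ {A B : Set} → (∀ (a a′ : A) → a ≡ a′) → (∀ (b b′ : B) → b ≡ b′) → ∀ (p q : A × B) → p ≡ q
  ×-irrelevant A-irr B-irr (a , b) (a′ , b′) = cong₂ _,_ (A-irr a a′) (B-irr b b′)

  module _ {P : ℕ → Set} (P? : Decidable P) (P-irrelevant : ∀ {l} (p q : P l) → p ≡ q) where

    counts-Σₚ-filter : ∀ N f {F : ℕ → PS} {C : ℕ → Class} → (∀ i → i < N → P (f i) → F (f i) counts C (f i)) →
      Σₚ (filter P? (applyUpTo f N)) F counts ⨁< N (λ i → guard (P (f i)) (C (f i)))
    counts-Σₚ-filter zero    f counts-term = counts-≅ counts-∅ (mk≅ (mk↔ₛ′ (λ ()) (λ ()) (λ ()) (λ ())) (λ ()))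
    counts-Σₚ-filter (suc N) f {F} {C} counts-term
      with P? (f 0) | counts-Σₚ-filter N (f ∘ suc) {F} {C} (λ i i<N → counts-term (suc i) (s≤s i<N))
    ... | yes p | rest = counts-≅ (counts-+ (counts-term 0 (s≤s z≤n) p) rest)
                                  (≅-trans (⊕-cong (guard-yes p P-irrelevant) ≅-refl) (⨁<-suc N _))
    ... | no ¬p | rest = counts-≅ rest (≅-trans ∅-⊕ (≅-trans (⊕-cong (guard-no ¬p) ≅-refl) (⨁<-suc N _)))

module OddChains where

  open import Defs using (Odd)
  open import Data.Nat using (zero; suc; _+_; _*_; _∸_; _<_; _≤_)
  import Data.Nat.Properties as ℕₚ
  open import Data.Nat.Tactic.RingSolver using (solve-∀)
  open import Data.Product using (_×_; _,_)
  open import Data.List using (List; []; _∷_)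
  open import Data.Unit using (⊤; tt)
  open import Relation.Nullary using (¬_)
  open import Relation.Binary.PropositionalEquality

  odd-1+2* : ∀ p → Odd (1 + 2 * p)
  odd-1+2* zero    = refl
  odd-1+2* (suc p) = subst Odd (shift p) (odd-1+2* p)
    where
    shift : ∀ p → 3 + 2 * p ≡ 1 + 2 * suc p
    shift = solve-∀

  odd-2*+ : ∀ d {n} → Odd n → Odd (2 * d + n)
  odd-2*+ zero    odd-n = odd-n
  odd-2*+ (suc d) {n} odd-n = subst Odd (shift d n) (odd-2*+ d odd-n)
    where
    shift : ∀ d n → 2 + (2 * d + n) ≡ 2 * suc d + n
    shift = solve-∀

  even-¬odd : ∀ p → ¬ Odd (2 * p)
  even-¬odd zero    ()
  even-¬odd (suc p) odd = even-¬odd p (subst Odd (shift p) odd)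
    where
    shift : ∀ p → 2 * suc p ≡ 2 + 2 * p
    shift = solve-∀

  odd⇒¬odd-suc : ∀ {n} → Odd n → ¬ Odd (suc n)
  odd⇒¬odd-suc {suc zero}    _   ()
  odd⇒¬odd-suc {suc (suc n)} odd = odd⇒¬odd-suc {n} odd

  odd⇒1+2* : ∀ {n} → Odd n → Σ ℕ λ p → n ≡ 1 + 2 * p
  odd⇒1+2* {suc zero}    _   = 0 , refl
  odd⇒1+2* {suc (suc n)} odd = let p , n≡1+2p = odd⇒1+2* {n} odd in suc p , trans (cong (2 +_) n≡1+2p) (shift p)
    where
    shift : ∀ p → 2 + (1 + 2 * p) ≡ 1 + 2 * suc p
    shift = solve-∀

  odd-gap : ∀ {a b} → Odd a → Odd b → a < b → Σ ℕ λ d → b ≡ 2 + 2 * d + a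
  odd-gap {a} {b} odd-a odd-b a<b with odd⇒1+2* {a} odd-a | odd⇒1+2* {b} odd-b
  ... | p , refl | q , refl = q ∸ suc p , trans (cong (λ t → 1 + 2 * t) (sym (ℕₚ.m+[n∸m]≡n p<q))) (regroup p (q ∸ suc p))
    where
    p<q : p < q
    p<q = ℕₚ.*-cancelˡ-< 2 p q (ℕₚ.≤-pred a<b)
    regroup : ∀ p d → 1 + 2 * (suc p + d) ≡ 2 + 2 * d + (1 + 2 * p)
    regroup = solve-∀

  odd-gap-unique : ∀ {a b d e} → b ≡ 2 + 2 * d + a → b ≡ 2 + 2 * e + a → d ≡ e
  odd-gap-unique {a} {b} {d} {e} b≡d b≡e =
    ℕₚ.*-cancelˡ-≡ d e 2 (ℕₚ.+-cancelʳ-≡ a (2 * d) (2 * e) (ℕₚ.suc-injective (ℕₚ.suc-injective (trans (sym b≡d) b≡e))))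

  OddChain : ℕ → ℕ → List ℕ → Set
  OddChain lo hi []       = ⊤
  OddChain lo hi (y ∷ ys) = Odd y × lo ≤ y × y < hi × OddChain lo y ys

  OddChain-irrelevant : ∀ {lo hi} ys (p q : OddChain lo hi ys) → p ≡ q
  OddChain-irrelevant []       tt tt = refl
  OddChain-irrelevant (y ∷ ys) (o , l , u , c) (o′ , l′ , u′ , c′) =
    cong₂ _,_ (ℕₚ.≡-irrelevant o o′)
      (cong₂ _,_ (ℕₚ.≤-irrelevant l l′) (cong₂ _,_ (ℕₚ.≤-irrelevant u u′) (OddChain-irrelevant ys c c′)))

  OddChain-weakenʳ : ∀ {lo hi hi′} ys → hi ≤ hi′ → OddChain lo hi ys → OddChain lo hi′ ys
  OddChain-weakenʳ []       _      tt              = tt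
  OddChain-weakenʳ (y ∷ ys) hi≤hi′ (o , l , u , c) = o , l , ℕₚ.<-≤-trans u hi≤hi′ , c

  OddChain-weakenˡ : ∀ {lo lo′ hi} ys → lo′ ≤ lo → OddChain lo hi ys → OddChain lo′ hi ys
  OddChain-weakenˡ []       _      tt              = tt
  OddChain-weakenˡ (y ∷ ys) lo′≤lo (o , l , u , c) = o , ℕₚ.≤-trans lo′≤lo l , u , OddChain-weakenˡ ys lo′≤lo c

  OddChain-mapˡ : ∀ {lo lo′ hi} ys → (∀ {y} → Odd y → lo ≤ y → lo′ ≤ y) → OddChain lo hi ys → OddChain lo′ hi ys
  OddChain-mapˡ []       f tt              = tt
  OddChain-mapˡ (y ∷ ys) f (o , l , u , c) = o , f o l , u , OddChain-mapˡ ys f c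

  OddChain-mapʳ : ∀ {lo hi hi′} ys → (∀ {y} → Odd y → y < hi → y < hi′) → OddChain lo hi ys → OddChain lo hi′ ys
  OddChain-mapʳ []       f tt              = tt
  OddChain-mapʳ (y ∷ ys) f (o , l , u , c) = o , l , f o u , c

  top : ℕ → List ℕ → ℕ
  top x []      = x
  top x (y ∷ _) = y

  OddAbove : ℕ → List ℕ → Set
  OddAbove x []       = ⊤
  OddAbove x (y ∷ ys) = Odd y × top x ys < y × OddAbove x ys

  OddAbove-irrelevant : ∀ {x} ys (p q : OddAbove x ys) → p ≡ q
  OddAbove-irrelevant []       tt tt = refl
  OddAbove-irrelevant (y ∷ ys) (o , l , a) (o′ , l′ , a′) =
    cong₂ _,_ (ℕₚ.≡-irrelevant o o′) (cong₂ _,_ (ℕₚ.≤-irrelevant l l′) (OddAbove-irrelevant ys a a′))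

  odd-top : ∀ {x} ys → Odd x → OddAbove x ys → Odd (top x ys)
  odd-top []       odd-x _       = odd-x
  odd-top (y ∷ ys) _     (o , _) = o

module OddPartClasses where

  open import Defs
  open import Data.Nat using (zero; suc; _+_; _*_; _∸_; _<_; _≤_; z≤n; s≤s; _≟_)
  import Data.Nat.Properties as ℕₚ
  open import Data.Nat.Tactic.RingSolver using (solve-∀)
  open import Data.Integer as ℤ using (1ℤ)
  import Data.Integer.Properties as ℤₚ
  open import Data.Nat.ListAction using (sum)
  open import Data.Product using (_×_; _,_; proj₁; proj₂)
  open import Data.Sum using (inj₁; inj₂)
  open import Data.List using (List; []; _∷_; length; applyUpTo)
  open import Data.Unit using (tt)
  open import Data.Empty using (⊥; ⊥-elim)
  open import Function using (_∘_)
  open import Function.Bundles using (mk↔ₛ′)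
  open import Relation.Nullary using (Dec; yes; no; ¬_)
  open import Relation.Binary.PropositionalEquality
  open import Algebra.Bundles using (CommutativeRing)
  open PowerSeries using (_≈_; coeffwise; PS-commutativeRing)
  open CommutativeRing PS-commutativeRing using () renaming (sym to ≈-sym)
  open QProducts using (Πₚ-upTo-suc; qbinomial; gaussN≈qbinomial)
  open Classes
  open OddChains

  OddPartsBelow : ℕ → Class
  OddPartsBelow b = class (Σ (List ℕ) (OddChain 0 b)) (sum ∘ proj₁)

  OddPartsBelow-split : ∀ j → OddPartsBelow (2 + 2 * j) ≅ OddPartsBelow (2 * j) ⊗ (pt 0 ⊕ pt (1 + 2 * j))
  OddPartsBelow-split j = mk≅ (mk↔ₛ′ to′ from′ to∘from from∘to) size′
    where
    B : ℕ
    B = 1 + 2 * j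
    below-2j : ∀ {y} → Odd y → y < 1 + B → ¬ y ≡ B → y < 2 * j
    below-2j o y<1+B y≢B = ℕₚ.≤∧≢⇒< (ℕₚ.≤-pred (ℕₚ.≤∧≢⇒< (ℕₚ.≤-pred y<1+B) y≢B)) λ { refl → even-¬odd j o }
    narrow : ∀ ys → OddChain 0 B ys → OddChain 0 (2 * j) ys
    narrow ys = OddChain-mapʳ ys λ o y<B → below-2j o (ℕₚ.m<n⇒m<1+n y<B) λ { refl → ℕₚ.<-irrefl refl y<B }
    Tgt : Set
    Tgt = Obj (OddPartsBelow (2 * j) ⊗ (pt 0 ⊕ pt B))
    split-at : ∀ y ys → Odd y → y < 1 + B → OddChain 0 y ys → Dec (y ≡ B) → Tgt
    split-at y ys o y<1+B c (yes refl) = (ys , narrow ys c) , inj₂ tt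
    split-at y ys o y<1+B c (no y≢B)   = (y ∷ ys , o , z≤n , below-2j o y<1+B y≢B , c) , inj₁ tt
    to′ : Obj (OddPartsBelow (2 + 2 * j)) → Tgt
    to′ ([]     , tt)              = ([] , tt) , inj₁ tt
    to′ (y ∷ ys , o , _ , y<1+B , c) = split-at y ys o y<1+B c (y ≟ B)
    from′ : Tgt → Obj (OddPartsBelow (2 + 2 * j))
    from′ ((ys , c) , inj₁ tt) = ys , OddChain-weakenʳ ys (ℕₚ.m≤n+m (2 * j) 2) c
    from′ ((ys , c) , inj₂ tt) = B ∷ ys , odd-1+2* j , z≤n , ℕₚ.≤-refl , OddChain-weakenʳ ys (ℕₚ.n≤1+n (2 * j)) c
    to∘from : ∀ t → to′ (from′ t) ≡ t
    to∘from (([] , tt) , inj₁ tt) = refl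
    to∘from ((y ∷ ys , o , _ , y<2j , c) , inj₁ tt) with y ≟ B
    ... | yes refl = ⊥-elim (ℕₚ.<-asym y<2j (ℕₚ.n<1+n (2 * j)))
    ... | no _     = cong (λ c′ → (y ∷ ys , c′) , inj₁ tt) (OddChain-irrelevant (y ∷ ys) _ _)
    to∘from ((ys , c) , inj₂ tt) with B ≟ B
    ... | yes refl = cong (λ c′ → (ys , c′) , inj₂ tt) (OddChain-irrelevant ys _ _)
    ... | no B≢B   = ⊥-elim (B≢B refl)
    from∘to : ∀ s → from′ (to′ s) ≡ s
    from∘to ([]     , tt)          = refl
    from∘to (y ∷ ys , o , _ , y<1+B , c) with y ≟ B
    ... | yes refl = cong (B ∷ ys ,_) (OddChain-irrelevant (B ∷ ys) _ _)
    ... | no _     = cong (y ∷ ys ,_) (OddChain-irrelevant (y ∷ ys) _ _)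
    size′ : ∀ s → size (OddPartsBelow (2 * j) ⊗ (pt 0 ⊕ pt B)) (to′ s) ≡ sum (proj₁ s)
    size′ ([]     , tt)          = refl
    size′ (y ∷ ys , o , _ , y<1+B , c) with y ≟ B
    ... | yes refl = ℕₚ.+-comm (sum ys) B
    ... | no _     = ℕₚ.+-identityʳ (y + sum ys)

  counts-OddPartsBelow : ∀ j → qpoch (ℤ.- 1ℤ) 1 2 j counts OddPartsBelow (2 * j)
  counts-OddPartsBelow zero    = counts-≅ counts-1 (mk≅ (mk↔ₛ′ (λ _ → [] , tt) (λ _ → tt) only-[] (λ _ → refl)) (λ _ → refl))
    where
    only-[] : ∀ s → ([] , tt) ≡ s
    only-[] ([] , tt) = refl
  counts-OddPartsBelow (suc j) =
    counts-≈ (≈-sym (Πₚ-upTo-suc j factor))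
      (counts-≅ (counts-* (counts-OddPartsBelow j) (counts-≈ factor≈ (counts-+ counts-1 (counts-pt (1 + 2 * j)))))
                (≅-trans (≅-sym (OddPartsBelow-split j)) (≡⇒≅ (cong OddPartsBelow (double-suc j)))))
    where
    factor : ℕ → PS
    factor t = 1ₚ -ₚ (ℤ.- 1ℤ) ·ₚ qⁿ (1 + 2 * t)
    factor≈ : 1ₚ +ₚ qⁿ (1 + 2 * j) ≈ factor j
    factor≈ = coeffwise λ n → cong (ℤ._+_ (1ₚ n)) (sym (trans (cong ℤ.-_ (ℤₚ.-1*i≡-i _)) (ℤₚ.neg-involutive _)))
    double-suc : ∀ j → 2 + 2 * j ≡ 2 * suc j
    double-suc = solve-∀

  GapProduct : ℕ → ℕ → Class
  GapProduct s zero    = pt 0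
  GapProduct s (suc R) = multiples (1 + 2 * s) ⊗ GapProduct (suc s) R

  counts-GapProduct : ∀ R → q2q2Inv R counts GapProduct 0 R
  counts-GapProduct R = counts-from R 0
    where
    applyUpTo-cong : ∀ {f g : ℕ → ℕ} R → (∀ t → f t ≡ g t) → applyUpTo f R ≡ applyUpTo g R
    applyUpTo-cong zero    f≗g = refl
    applyUpTo-cong (suc R) f≗g = cong₂ _∷_ (f≗g 0) (applyUpTo-cong R (f≗g ∘ suc))
    γ : ℕ → PS
    γ t = geomInv 1ℤ (1 + 2 * t)
    counts-from : ∀ R s → Πₚ (applyUpTo (s +_) R) γ counts GapProduct s R
    counts-from zero    s = counts-1
    counts-from (suc R) s = counts-*
      (subst (λ u → γ u counts multiples (1 + 2 * s)) (sym (ℕₚ.+-identityʳ s)) (counts-multiples (1 + 2 * s)))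
      (subst (λ xs → Πₚ xs γ counts GapProduct (suc s) R) (applyUpTo-cong R (λ t → sym (ℕₚ.+-suc s t))) (counts-from R (suc s)))

  -- The extra weight s · (top part) is what makes the induction on the number of parts go through.
  OddPartsAbove : ℕ → ℕ → ℕ → Class
  OddPartsAbove x s R = class (Σ (List ℕ) λ ys → OddAbove x ys × length ys ≡ R) λ (ys , _) → sum ys + s * top x ys

  OddPartsAbove-peel : ∀ {x} → Odd x → ∀ s R →
    OddPartsAbove x s (suc R) ≅ pt (2 + 2 * s) ⊗ multiples (1 + 2 * s) ⊗ OddPartsAbove x (suc s) R
  OddPartsAbove-peel {x} odd-x s R = mk≅ (mk↔ₛ′ to′ from′ to∘from from∘to) size′
    where
    P : List ℕ → Set
    P ys = OddAbove x ys × length ys ≡ R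
    P-irrelevant : ∀ {R ys} (p q : OddAbove x ys × length ys ≡ R) → p ≡ q
    P-irrelevant {ys = ys} = ×-irrelevant (OddAbove-irrelevant ys) ℕₚ.≡-irrelevant
    gap : ∀ y ys → Odd y → top x ys < y → OddAbove x ys → Σ ℕ λ d → y ≡ 2 + 2 * d + top x ys
    gap y ys o lt a = odd-gap (odd-top ys odd-x a) o lt
    to′ : Obj (OddPartsAbove x s (suc R)) → Obj (pt (2 + 2 * s) ⊗ multiples (1 + 2 * s) ⊗ OddPartsAbove x (suc s) R)
    to′ (y ∷ ys , (o , lt , a) , e) = tt , proj₁ (gap y ys o lt a) , ys , a , ℕₚ.suc-injective e
    from′ : Obj (pt (2 + 2 * s) ⊗ multiples (1 + 2 * s) ⊗ OddPartsAbove x (suc s) R) → Obj (OddPartsAbove x s (suc R))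
    from′ (tt , d , ys , a , e) =
      (2 + 2 * d + top x ys) ∷ ys , (odd-2*+ d (odd-top ys odd-x a) , s≤s (ℕₚ.m≤n+m (top x ys) (suc (2 * d))) , a) , cong suc e
    to∘from : ∀ t → to′ (from′ t) ≡ t
    to∘from (tt , d , ys , a , e) = cong₂ (λ d′ p → tt , d′ , ys , p)
      (sym (odd-gap-unique refl (proj₂ (gap (2 + 2 * d + top x ys) ys _ _ a)))) (P-irrelevant _ _)
    from∘to : ∀ u → from′ (to′ u) ≡ u
    from∘to (y ∷ ys , (o , lt , a) , e) = subtype-≡ P-irrelevant (cong (_∷ ys) (sym (proj₂ (gap y ys o lt a))))
    size′ : ∀ u → size (pt (2 + 2 * s) ⊗ multiples (1 + 2 * s) ⊗ OddPartsAbove x (suc s) R) (to′ u) ≡ size (OddPartsAbove x s (suc R)) u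
    size′ (y ∷ ys , (o , lt , a) , e) with gap y ys o lt a
    ... | d , refl = regroup s d (top x ys) (sum ys)
      where
      regroup : ∀ s d t S → (2 + 2 * s) + ((2 + 2 * s) * d + (S + (1 + s) * t)) ≡ ((2 + 2 * d + t) + S) + s * (2 + 2 * d + t)
      regroup = solve-∀

  -- The size in OddPartsAbove x s R of the smallest configuration x + 2R > ⋯ > x + 2.
  offset-above : ℕ → ℕ → ℕ → ℕ
  offset-above s R x = (R + s) * x + R * (R + 1) + 2 * s * R

  OddPartsAbove-≅ : ∀ {x} → Odd x → ∀ R s → OddPartsAbove x s R ≅ pt (offset-above s R x) ⊗ GapProduct s R
  OddPartsAbove-≅ {x} odd-x zero    s = mk≅ (mk↔ₛ′ (λ _ → tt , tt) (λ _ → [] , tt , refl) (λ _ → refl) only-[]) size′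
    where
    only-[] : ∀ u → ([] , tt , refl) ≡ u
    only-[] ([] , tt , refl) = refl
    size′ : ∀ u → offset-above s 0 x + 0 ≡ size (OddPartsAbove x s 0) u
    size′ ([] , tt , refl) = regroup s x
      where
      regroup : ∀ s x → (0 + s) * x + 0 * (0 + 1) + 2 * s * 0 + 0 ≡ 0 + s * x
      regroup = solve-∀
  OddPartsAbove-≅ {x} odd-x (suc R) s =
    ≅-trans (OddPartsAbove-peel odd-x s R)
      (≅-trans (⊗-cong (≅-refl {pt (2 + 2 * s)}) (⊗-cong (≅-refl {multiples (1 + 2 * s)}) (OddPartsAbove-≅ odd-x R (suc s))))
               (pt-merge {2 + 2 * s} {offset-above (suc s) R x} {C = multiples (1 + 2 * s)} {D = GapProduct (suc s) R} (offsets s R x)))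
    where
    offsets : ∀ s R x → 2 + 2 * s + ((R + suc s) * x + R * (R + 1) + 2 * suc s * R)
                      ≡ (suc R + s) * x + suc R * (suc R + 1) + 2 * s * suc R
    offsets = solve-∀

  Pascal : ℕ → ℕ → Class
  Pascal N       zero    = pt 0
  Pascal zero    (suc L) = ∅
  Pascal (suc N) (suc L) = Pascal N (suc L) ⊕ pt (2 * (N ∸ L)) ⊗ Pascal N L

  counts-Pascal : ∀ N L → gaussN N L counts Pascal N L
  counts-Pascal N L = counts-≈ (≈-sym (gaussN≈qbinomial N L)) (counts-qbinomial N L)
    where
    counts-qbinomial : ∀ N L → qbinomial N L counts Pascal N L
    counts-qbinomial N       zero    = counts-1
    counts-qbinomial zero    (suc L) = counts-∅
    counts-qbinomial (suc N) (suc L) = counts-+ (counts-qbinomial N (suc L)) (counts-* (counts-pt _) (counts-qbinomial N L))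

  Pascal-bound : ∀ N L → Obj (Pascal N L) → L ≤ N
  Pascal-bound N       zero    _               = z≤n
  Pascal-bound (suc N) (suc L) (inj₁ x)        = ℕₚ.m≤n⇒m≤1+n (Pascal-bound N (suc L) x)
  Pascal-bound (suc N) (suc L) (inj₂ (_ , x))  = s≤s (Pascal-bound N L x)

  OddPartsBetween : ℕ → ℕ → ℕ → Class
  OddPartsBetween m₀ N L = class (Σ (List ℕ) λ ys → OddChain m₀ (2 * N + m₀) ys × length ys ≡ L) (sum ∘ proj₁)

  -- The size of the smallest configuration m₀ + 2(L − 1) > ⋯ > m₀.
  offset-between : ℕ → ℕ → ℕ
  offset-between m₀ L = L * m₀ + L * (L ∸ 1)

  module _ {m₀ : ℕ} (odd-m₀ : Odd m₀) where

    private
      bound : ℕ → ℕ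
      bound N = 2 * N + m₀

      bound-suc : ∀ N → bound (suc N) ≡ 2 + bound N
      bound-suc N = shift N m₀
        where
        shift : ∀ N m₀ → 2 * suc N + m₀ ≡ 2 + (2 * N + m₀)
        shift = solve-∀

      bound<bound-suc : ∀ N → bound N < bound (suc N)
      bound<bound-suc N = subst (bound N <_) (sym (bound-suc N)) (ℕₚ.n≤1+n _)

      below-bound : ∀ N {y} → Odd y → y < bound (suc N) → ¬ y ≡ bound N → y < bound N
      below-bound N {y} o y<b′ y≢b = ℕₚ.≤∧≢⇒< (ℕₚ.≤-pred (ℕₚ.≤∧≢⇒< (ℕₚ.≤-pred (subst (y <_) (bound-suc N) y<b′))
        λ { refl → odd⇒¬odd-suc {bound N} (odd-2*+ N odd-m₀) o })) y≢b

      Irrelevant : ∀ N L ys (p q : OddChain m₀ (bound N) ys × length ys ≡ L) → p ≡ q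
      Irrelevant N L ys = ×-irrelevant (OddChain-irrelevant ys) ℕₚ.≡-irrelevant

    OddPartsBetween-split : ∀ N L →
      OddPartsBetween m₀ (suc N) (suc L) ≅ OddPartsBetween m₀ N (suc L) ⊕ pt (bound N) ⊗ OddPartsBetween m₀ N L
    OddPartsBetween-split N L = mk≅ (mk↔ₛ′ to′ from′ to∘from from∘to) size′
      where
      Tgt : Set
      Tgt = Obj (OddPartsBetween m₀ N (suc L) ⊕ pt (bound N) ⊗ OddPartsBetween m₀ N L)
      split-at : ∀ y ys → Odd y → m₀ ≤ y → y < bound (suc N) → OddChain m₀ y ys → length ys ≡ L → Dec (y ≡ bound N) → Tgt
      split-at y ys o l u c e (yes refl) = inj₂ (tt , ys , c , e)
      split-at y ys o l u c e (no y≢b)   = inj₁ (y ∷ ys , (o , l , below-bound N o u y≢b , c) , cong suc e)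
      to′ : Obj (OddPartsBetween m₀ (suc N) (suc L)) → Tgt
      to′ (y ∷ ys , (o , l , u , c) , e) = split-at y ys o l u c (ℕₚ.suc-injective e) (y ≟ bound N)
      from′ : Tgt → Obj (OddPartsBetween m₀ (suc N) (suc L))
      from′ (inj₁ (ys , c , e))      = ys , OddChain-weakenʳ ys (ℕₚ.<⇒≤ (bound<bound-suc N)) c , e
      from′ (inj₂ (tt , ys , c , e)) = bound N ∷ ys , (odd-2*+ N odd-m₀ , ℕₚ.m≤n+m m₀ (2 * N) , bound<bound-suc N , c) , cong suc e
      to∘from : ∀ t → to′ (from′ t) ≡ t
      to∘from (inj₁ (y ∷ ys , (o , l , u , c) , e)) with y ≟ bound N
      ... | yes refl = ⊥-elim (ℕₚ.<-irrefl refl u)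
      ... | no _     = cong inj₁ (subtype-≡ (Irrelevant N (suc L) _) refl)
      to∘from (inj₂ (tt , ys , c , e)) with bound N ≟ bound N
      ... | yes refl = cong (λ p → inj₂ (tt , ys , p)) (Irrelevant N L ys _ _)
      ... | no b≢b   = ⊥-elim (b≢b refl)
      from∘to : ∀ s → from′ (to′ s) ≡ s
      from∘to (y ∷ ys , (o , l , u , c) , e) with y ≟ bound N
      ... | yes refl = subtype-≡ (Irrelevant (suc N) (suc L) _) refl
      ... | no _     = subtype-≡ (Irrelevant (suc N) (suc L) _) refl
      size′ : ∀ s → size (OddPartsBetween m₀ N (suc L) ⊕ pt (bound N) ⊗ OddPartsBetween m₀ N L) (to′ s) ≡ sum (proj₁ s)
      size′ (y ∷ ys , (o , l , u , c) , e) with y ≟ bound N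
      ... | yes refl = refl
      ... | no _     = refl

    OddPartsBetween-≅ : ∀ N L → OddPartsBetween m₀ N L ≅ pt (offset-between m₀ L) ⊗ Pascal N L
    OddPartsBetween-≅ N zero = mk≅ (mk↔ₛ′ (λ _ → tt , tt) (λ _ → [] , tt , refl) (λ _ → refl) only-[]) only-[]-size
      where
      only-[] : ∀ u → ([] , tt , refl) ≡ u
      only-[] ([] , tt , refl) = refl
      only-[]-size : ∀ u → 0 ≡ sum (proj₁ u)
      only-[]-size ([] , tt , refl) = refl
    OddPartsBetween-≅ zero (suc L) = mk≅ (mk↔ₛ′ (⊥-elim ∘ empty) (λ ()) (λ ()) (⊥-elim ∘ empty)) (⊥-elim ∘ empty)
      where
      empty : Obj (OddPartsBetween m₀ 0 (suc L)) → ⊥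
      empty (y ∷ _ , (_ , m₀≤y , y<m₀ , _) , _) = ℕₚ.<-irrefl refl (ℕₚ.<-≤-trans y<m₀ m₀≤y)
    OddPartsBetween-≅ (suc N) (suc L) =
      ≅-trans (OddPartsBetween-split N L)
        (≅-trans (⊕-cong (OddPartsBetween-≅ N (suc L)) (≅-trans (⊗-cong (≅-refl {pt (bound N)}) (OddPartsBetween-≅ N L)) shift-offset))
                 (≅-sym ⊗-distribˡ-⊕))
      where
      shift-offset : pt (bound N) ⊗ pt (offset-between m₀ L) ⊗ Pascal N L ≅ pt (offset-between m₀ (suc L)) ⊗ pt (2 * (N ∸ L)) ⊗ Pascal N L
      shift-offset = mk≅ (mk↔ₛ′ (λ (_ , _ , x) → tt , tt , x) (λ (_ , _ , x) → tt , tt , x) (λ _ → refl) (λ _ → refl))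
                         (λ (_ , _ , x) → offsets x)
        where
        offsets : ∀ x → offset-between m₀ (suc L) + (2 * (N ∸ L) + size (Pascal N L) x) ≡ bound N + (offset-between m₀ L + size (Pascal N L) x)
        offsets x with N ∸ L | ℕₚ.m+[n∸m]≡n (Pascal-bound N L x)
        ... | t | refl = regroup m₀ L t (size (Pascal N L) x)
          where
          regroup : ∀ m₀ L t w → suc L * m₀ + suc L * L + (2 * t + w) ≡ 2 * (L + t) + m₀ + (L * m₀ + L * (L ∸ 1) + w)
          regroup m₀ zero    t w = regroup₀ m₀ t w
            where
            regroup₀ : ∀ m₀ t w → 1 * m₀ + 1 * 0 + (2 * t + w) ≡ 2 * (0 + t) + m₀ + (0 * m₀ + 0 * 0 + w)
            regroup₀ = solve-∀
          regroup m₀ (suc L) t w = regroup₊ m₀ L t w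
            where
            regroup₊ : ∀ m₀ L t w → (2 + L) * m₀ + (2 + L) * (1 + L) + (2 * t + w) ≡ 2 * ((1 + L) + t) + m₀ + ((1 + L) * m₀ + (1 + L) * L + w)
            regroup₊ = solve-∀

module HookRowSplit where

  open import Defs
  open import Data.Nat using (zero; suc; _+_; _<_; _>_; _≤_; _≤?_; z≤n)
  import Data.Nat.Properties as ℕₚ
  open import Data.Integer as ℤ using (ℤ; +_; 1ℤ)
  import Data.Integer.Properties as ℤₚ
  import Data.Integer.Tactic.RingSolver as ℤ-Ring
  open import Data.Nat.ListAction using (sum)
  open import Data.Nat.ListAction.Properties using (sum-++)
  open import Data.Product using (Σ; _×_; _,_; proj₁; proj₂)
  open import Data.List using (List; []; _∷_; _++_; length; filter)
  import Data.List.Properties as Listₚ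
  open import Data.List.Relation.Unary.Linked as Linked using (Linked; []; [-]; _∷_)
  open import Data.List.Relation.Unary.All as All using (All; []; _∷_)
  import Data.List.Relation.Unary.All.Properties as Allₚ
  open import Data.Unit using (⊤; tt)
  open import Data.Empty using (⊥-elim)
  open import Function using (_∘_)
  open import Function.Bundles using (mk↔ₛ′)
  open import Relation.Nullary using (yes; no)
  open import Relation.Binary.PropositionalEquality
  open import Axiom.UniquenessOfIdentityProofs using (module Decidable⇒UIP)
  open Classes
  open OddChains

  OddDecreasing : List ℕ → Set
  OddDecreasing []       = ⊤
  OddDecreasing (y ∷ ys) = Odd y × OddChain 0 y ys

  private
    linked⇒chain : ∀ y ys → Linked _>_ (y ∷ ys) → All Odd ys → OddChain 0 y ys
    linked⇒chain y []       _              _            = tt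
    linked⇒chain y (z ∷ zs) (y>z ∷ linked) (odd-z ∷ odd) = odd-z , z≤n , y>z , linked⇒chain z zs linked odd

    chain⇒linked : ∀ y ys → OddChain 0 y ys → Linked _>_ (y ∷ ys) × All Odd ys
    chain⇒linked y []       tt                    = [-] , []
    chain⇒linked y (z ∷ zs) (odd-z , _ , y>z , c) =
      let linked , odd = chain⇒linked z zs c in y>z ∷ linked , odd-z ∷ odd

  distinct-odd⇒OddDecreasing : ∀ λs → Linked _>_ λs × All Odd λs → OddDecreasing λs
  distinct-odd⇒OddDecreasing []       _                    = tt
  distinct-odd⇒OddDecreasing (y ∷ ys) (linked , odd-y ∷ odd) = odd-y , linked⇒chain y ys linked odd

  OddDecreasing⇒distinct-odd : ∀ λs → OddDecreasing λs → Linked _>_ λs × All Odd λs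
  OddDecreasing⇒distinct-odd []       tt          = [] , []
  OddDecreasing⇒distinct-odd (y ∷ ys) (odd-y , c) = let linked , odd = chain⇒linked y ys c in linked , odd-y ∷ odd

  OddChain-++⁻ : ∀ {y} t x rest → OddChain 0 y (t ++ x ∷ rest) → top x t < y × OddAbove x t × Odd x × OddChain 0 x rest
  OddChain-++⁻ []      x rest (odd-x , _ , x<y , c) = x<y , tt , odd-x , c
  OddChain-++⁻ (z ∷ t) x rest (odd-z , _ , z<y , c) =
    let t<z , above , odd-x , c′ = OddChain-++⁻ t x rest c in z<y , (odd-z , t<z , above) , odd-x , c′

  OddChain-++⁺ : ∀ {y} t x rest → top x t < y → OddAbove x t → Odd x → OddChain 0 x rest → OddChain 0 y (t ++ x ∷ rest)
  OddChain-++⁺ []      x rest x<y tt                    odd-x c = odd-x , z≤n , x<y , c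
  OddChain-++⁺ (z ∷ t) x rest z<y (odd-z , t<z , above) odd-x c = odd-z , z≤n , z<y , OddChain-++⁺ t x rest t<z above odd-x c

  OddDecreasing-++⁻ : ∀ t x rest → OddDecreasing (t ++ x ∷ rest) → OddAbove x t × Odd x × OddChain 0 x rest
  OddDecreasing-++⁻ []      x rest (odd-x , c) = tt , odd-x , c
  OddDecreasing-++⁻ (z ∷ t) x rest (odd-z , c) = let t<z , above , rest′ = OddChain-++⁻ t x rest c in (odd-z , t<z , above) , rest′

  OddDecreasing-++⁺ : ∀ t x rest → OddAbove x t → Odd x → OddChain 0 x rest → OddDecreasing (t ++ x ∷ rest)
  OddDecreasing-++⁺ []      x rest tt                    odd-x c = odd-x , c
  OddDecreasing-++⁺ (z ∷ t) x rest (odd-z , t<z , above) odd-x c = odd-z , OddChain-++⁺ t x rest t<z above odd-x c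

  OddChain-concat : ∀ {lo hi} mid bot → lo ≤ hi → OddChain lo hi mid → OddChain 0 lo bot → OddChain 0 hi (mid ++ bot)
  OddChain-concat []        bot lo≤hi tt                  c = OddChain-weakenʳ bot lo≤hi c
  OddChain-concat (y ∷ mid) bot _     (odd-y , lo≤y , y<hi , c′) c = odd-y , z≤n , y<hi , OddChain-concat mid bot lo≤y c′ c

  OddChain-All-≥ : ∀ {lo hi} ys → OddChain lo hi ys → All (lo ≤_) ys
  OddChain-All-≥ []       tt              = []
  OddChain-All-≥ (y ∷ ys) (_ , l , _ , c) = l ∷ OddChain-All-≥ ys c

  OddChain-All-< : ∀ {lo hi} ys → OddChain lo hi ys → All (_< hi) ys
  OddChain-All-< []       tt              = []
  OddChain-All-< (y ∷ ys) (_ , _ , u , c) = u ∷ All.map (λ z<y → ℕₚ.<-trans z<y u) (OddChain-All-< ys c)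

  x≤top : ∀ {x} t → OddAbove x t → x ≤ top x t
  x≤top []      tt           = ℕₚ.≤-refl
  x≤top (y ∷ t) (_ , lt , a) = ℕₚ.<⇒≤ (ℕₚ.≤-<-trans (x≤top t a) lt)

  OddAbove-All-> : ∀ {x} t → OddAbove x t → All (x <_) t
  OddAbove-All-> []      tt           = []
  OddAbove-All-> (y ∷ t) (_ , lt , a) = ℕₚ.≤-<-trans (x≤top t a) lt ∷ OddAbove-All-> t a

  part-++ : ∀ t x rest → part (t ++ x ∷ rest) (suc (length t)) ≡ x
  part-++ []      x rest = refl
  part-++ (y ∷ t) x rest = part-++ t x rest

  conj-++ : ∀ {m x} t mid bot → OddAbove x t → m ≤ x → OddChain m x mid → OddChain 0 m bot →
    conj (t ++ x ∷ mid ++ bot) m ≡ length t + suc (length mid)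
  conj-++ {m} {x} t mid bot above m≤x c-mid c-bot = begin
    length (filter (m ≤?_) (t ++ x ∷ mid ++ bot))   ≡⟨ cong (length ∘ filter (m ≤?_)) (sym (Listₚ.++-assoc t (x ∷ mid) bot)) ⟩
    length (filter (m ≤?_) ((t ++ x ∷ mid) ++ bot)) ≡⟨ length-filter-≥ (t ++ x ∷ mid) bot large (OddChain-All-< bot c-bot) ⟩
    length (t ++ x ∷ mid)                           ≡⟨ Listₚ.length-++ t ⟩
    length t + suc (length mid)                     ∎
    where
    open ≡-Reasoning
    large : All (m ≤_) (t ++ x ∷ mid)
    large = Allₚ.++⁺ (All.map (λ x<y → ℕₚ.<⇒≤ (ℕₚ.≤-<-trans m≤x x<y)) (OddAbove-All-> t above)) (m≤x ∷ OddChain-All-≥ mid c-mid)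
    length-filter-≥ : ∀ as bs → All (m ≤_) as → All (_< m) bs → length (filter (m ≤?_) (as ++ bs)) ≡ length as
    length-filter-≥ []       []       _            _            = refl
    length-filter-≥ []       (b ∷ bs) _            (b<m ∷ bs<m) =
      trans (cong length (Listₚ.filter-reject (m ≤?_) (ℕₚ.<⇒≱ b<m))) (length-filter-≥ [] bs [] bs<m)
    length-filter-≥ (a ∷ as) bs       (m≤a ∷ as≥m) bs<m         =
      trans (cong length (Listₚ.filter-accept (m ≤?_) m≤a)) (cong suc (length-filter-≥ as bs as≥m bs<m))

  split≥ : ℕ → List ℕ → List ℕ × List ℕ
  split≥ m []       = [] , []
  split≥ m (y ∷ ys) with m ≤? y
  ... | yes _ = y ∷ proj₁ (split≥ m ys) , proj₂ (split≥ m ys)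
  ... | no _  = [] , y ∷ ys

  split≥-++ : ∀ m ys → proj₁ (split≥ m ys) ++ proj₂ (split≥ m ys) ≡ ys
  split≥-++ m []       = refl
  split≥-++ m (y ∷ ys) with m ≤? y
  ... | yes _ = cong (y ∷_) (split≥-++ m ys)
  ... | no _  = refl

  split≥-chains : ∀ {m hi} ys → OddChain 0 hi ys → m ≤ hi → OddChain m hi (proj₁ (split≥ m ys)) × OddChain 0 m (proj₂ (split≥ m ys))
  split≥-chains     []       tt                 _    = tt , tt
  split≥-chains {m} (y ∷ ys) (odd-y , _ , y<hi , c) m≤hi with m ≤? y
  ... | yes m≤y = let mid , bot = split≥-chains ys c m≤y in (odd-y , m≤y , y<hi , mid) , bot
  ... | no m≰y  = tt , (odd-y , z≤n , ℕₚ.≰⇒> m≰y , c)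

  split≥-inverse : ∀ {m hi} mid bot → OddChain m hi mid → OddChain 0 m bot → split≥ m (mid ++ bot) ≡ (mid , bot)
  split≥-inverse {m} []        []        tt _ = refl
  split≥-inverse {m} []        (y ∷ bot) tt (_ , _ , y<m , _) with m ≤? y
  ... | yes m≤y = ⊥-elim (ℕₚ.<⇒≱ y<m m≤y)
  ... | no _    = refl
  split≥-inverse {m} (y ∷ mid) bot (_ , m≤y , _ , c) c-bot with m ≤? y
  ... | yes _   = cong (λ (mid′ , bot′) → y ∷ mid′ , bot′) (split≥-inverse mid bot c c-bot)
  ... | no m≰y  = ⊥-elim (m≰y m≤y)

  record RowSplit (r : ℕ) (λs : List ℕ) : Set where
    constructor rowSplit
    field
      above        : List ℕ
      row          : ℕ
      below        : List ℕ
      length-above : length above ≡ r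
      reassemble   : above ++ row ∷ below ≡ λs

  rowSplit-at : ∀ r λs → 0 < part λs (suc r) → RowSplit r λs
  rowSplit-at zero    (y ∷ ys) _ = rowSplit [] y ys refl refl
  rowSplit-at (suc r) (y ∷ ys) p =
    let rowSplit t x rest |t|≡r t++x∷rest≡ys = rowSplit-at r ys p in rowSplit (y ∷ t) x rest (cong suc |t|≡r) (cong (y ∷_) t++x∷rest≡ys)

  ++-∷-cancel : ∀ (t : List ℕ) x rest t′ x′ rest′ → t ++ x ∷ rest ≡ t′ ++ x′ ∷ rest′ → length t ≡ length t′ →
                t ≡ t′ × x ≡ x′ × rest ≡ rest′
  ++-∷-cancel []      x rest []        x′ rest′ refl _ = refl , refl , refl
  ++-∷-cancel (a ∷ t) x rest (a′ ∷ t′) x′ rest′ eq |t|≡|t′| with Listₚ.∷-injective eq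
  ... | refl , eq′ = let t≡t′ , x≡x′ , rest≡rest′ = ++-∷-cancel t x rest t′ x′ rest′ eq′ (ℕₚ.suc-injective |t|≡|t′|)
                     in cong (a ∷_) t≡t′ , x≡x′ , rest≡rest′

  hook-at-row : ∀ λs {r m x L} → part λs (suc r) ≡ x → conj λs m ≡ r + suc L → hook λs (suc r) m ≡ + (x + suc L) ℤ.- + m
  hook-at-row λs {r} {m} {x} {L} part≡x conj≡ = begin
    hook λs (suc r) m                                   ≡⟨ cong₂ (λ p c → + p ℤ.+ + c ℤ.- + suc r ℤ.- + m ℤ.+ 1ℤ) part≡x conj≡ ⟩
    + x ℤ.+ + (r + suc L) ℤ.- + suc r ℤ.- + m ℤ.+ 1ℤ   ≡⟨ identity (+ x) (+ r) (+ L) (+ m) ⟩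
    + (x + suc L) ℤ.- + m                               ∎
    where
    open ≡-Reasoning
    identity : ∀ x r L m → x ℤ.+ (r ℤ.+ (1ℤ ℤ.+ L)) ℤ.- (1ℤ ℤ.+ r) ℤ.- m ℤ.+ 1ℤ ≡ (x ℤ.+ (1ℤ ℤ.+ L)) ℤ.- m
    identity = ℤ-Ring.solve-∀

  -⁺≡⇒≡+ : ∀ {a m k} → + a ℤ.- + m ≡ + k → a ≡ m + k
  -⁺≡⇒≡+ {a} {m} {k} eq = trans (ℤₚ.+-injective (trans (sym (cancel (+ a) (+ m))) (cong (ℤ._+ + m) eq))) (ℕₚ.+-comm k m)
    where
    cancel : ∀ a m → a ℤ.- m ℤ.+ m ≡ a
    cancel = ℤ-Ring.solve-∀

  ≡+⇒-⁺≡ : ∀ {a m k} → a ≡ m + k → + a ℤ.- + m ≡ + k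
  ≡+⇒-⁺≡ {m = m} {k} refl = cancel (+ m) (+ k)
    where
    cancel : ∀ m k → m ℤ.+ k ℤ.- m ≡ k
    cancel = ℤ-Ring.solve-∀

  HookPartitions : ℕ → ℕ → ℕ → Class
  HookPartitions m s k = class (Σ (List ℕ) λ λs → (Linked _>_ λs × All Odd λs) × m ≤ part λs s × hook λs s m ≡ + k) (sum ∘ proj₁)

  Shape : Set
  Shape = List ℕ × ℕ × List ℕ × List ℕ

  HookShape : ℕ → ℕ → ℕ → Shape → Set
  HookShape m r k (t , x , mid , bot) =
    OddAbove x t × length t ≡ r × Odd x × m ≤ x × OddChain m x mid × OddChain 0 m bot × x + suc (length mid) ≡ m + k

  HookShape-irrelevant : ∀ {m r k} s (p q : HookShape m r k s) → p ≡ q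
  HookShape-irrelevant (t , x , mid , bot) =
    ×-irrelevant (OddAbove-irrelevant t) (×-irrelevant ℕₚ.≡-irrelevant (×-irrelevant ℕₚ.≡-irrelevant (×-irrelevant ℕₚ.≤-irrelevant
      (×-irrelevant (OddChain-irrelevant mid) (×-irrelevant (OddChain-irrelevant bot) ℕₚ.≡-irrelevant)))))

  Decomposed : ℕ → ℕ → ℕ → Class
  Decomposed m r k = class (Σ Shape (HookShape m r k)) λ ((t , x , mid , bot) , _) → sum t + (x + (sum mid + sum bot))

  module _ {m : ℕ} (1≤m : 1 ≤ m) (r k : ℕ) where

    private
      assemble : Σ Shape (HookShape m r k) → Obj (HookPartitions m (suc r) k)
      assemble ((t , x , mid , bot) , above , |t|≡r , odd-x , m≤x , c-mid , c-bot , hook≡) =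
        λs , OddDecreasing⇒distinct-odd λs (OddDecreasing-++⁺ t x (mid ++ bot) above odd-x (OddChain-concat mid bot m≤x c-mid c-bot))
           , subst (m ≤_) (sym part≡x) m≤x
           , trans (hook-at-row λs part≡x conj≡) (≡+⇒-⁺≡ hook≡)
        where
        λs : List ℕ
        λs = t ++ x ∷ mid ++ bot
        part≡x : part λs (suc r) ≡ x
        part≡x = subst (λ u → part λs (suc u) ≡ x) |t|≡r (part-++ t x (mid ++ bot))
        conj≡ : conj λs m ≡ r + suc (length mid)
        conj≡ = trans (conj-++ t mid bot above m≤x c-mid c-bot) (cong (_+ suc (length mid)) |t|≡r)

      decompose-at : (p : Obj (HookPartitions m (suc r) k)) → RowSplit r (proj₁ p) → Σ Shape (HookShape m r k)
      decompose-at (λs , distinct , m≤part , hook≡) (rowSplit t x rest |t|≡r t++x∷rest≡λs) =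
        (t , x , mid , bot) , above , |t|≡r , odd-x , m≤x , c-mid , c-bot , -⁺≡⇒≡+ (trans (sym (hook-at-row λs part≡x conj≡)) hook≡)
        where
        mid bot : List ℕ
        mid = proj₁ (split≥ m rest)
        bot = proj₂ (split≥ m rest)
        pieces : OddAbove x t × Odd x × OddChain 0 x rest
        pieces = OddDecreasing-++⁻ t x rest (subst OddDecreasing (sym t++x∷rest≡λs) (distinct-odd⇒OddDecreasing λs distinct))
        above : OddAbove x t
        above = proj₁ pieces
        odd-x : Odd x
        odd-x = proj₁ (proj₂ pieces)
        part≡x : part λs (suc r) ≡ x
        part≡x = subst (λ l → part l (suc r) ≡ x) t++x∷rest≡λs (subst (λ u → part (t ++ x ∷ rest) (suc u) ≡ x) |t|≡r (part-++ t x rest))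
        m≤x : m ≤ x
        m≤x = subst (m ≤_) part≡x m≤part
        c-mid : OddChain m x mid
        c-mid = proj₁ (split≥-chains rest (proj₂ (proj₂ pieces)) m≤x)
        c-bot : OddChain 0 m bot
        c-bot = proj₂ (split≥-chains rest (proj₂ (proj₂ pieces)) m≤x)
        λs≡ : t ++ x ∷ mid ++ bot ≡ λs
        λs≡ = trans (cong (λ ys → t ++ x ∷ ys) (split≥-++ m rest)) t++x∷rest≡λs
        conj≡ : conj λs m ≡ r + suc (length mid)
        conj≡ = subst (λ l → conj l m ≡ r + suc (length mid)) λs≡
                  (trans (conj-++ t mid bot above m≤x c-mid c-bot) (cong (_+ suc (length mid)) |t|≡r))

      row-of : (p : Obj (HookPartitions m (suc r) k)) → RowSplit r (proj₁ p)
      row-of (λs , _ , m≤part , _) = rowSplit-at r λs (ℕₚ.<-≤-trans 1≤m m≤part)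

      decompose∘assemble : ∀ s (v : RowSplit r (proj₁ (assemble s))) → decompose-at (assemble s) v ≡ s
      decompose∘assemble ((t , x , mid , bot) , above , |t|≡r , odd-x , m≤x , c-mid , c-bot , hook≡) (rowSplit t′ x′ rest′ |t′|≡r eq)
        with ++-∷-cancel t′ x′ rest′ t x (mid ++ bot) eq (trans |t′|≡r (sym |t|≡r))
      ... | refl , refl , refl =
        subtype-≡ (HookShape-irrelevant _) (cong (λ (mid′ , bot′) → t , x , mid′ , bot′) (split≥-inverse mid bot c-mid c-bot))

      assemble∘decompose : ∀ p (v : RowSplit r (proj₁ p)) → assemble (decompose-at p v) ≡ p
      assemble∘decompose (λs , _) (rowSplit t x rest _ t++x∷rest≡λs) =
        subtype-≡ (×-irrelevant (×-irrelevant (Linked.irrelevant ℕₚ.<-irrelevant) (All.irrelevant ℕₚ.≡-irrelevant))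
                                (×-irrelevant ℕₚ.≤-irrelevant (Decidable⇒UIP.≡-irrelevant ℤ._≟_)))
                  (trans (cong (λ ys → t ++ x ∷ ys) (split≥-++ m rest)) t++x∷rest≡λs)

      size-decompose : ∀ p (v : RowSplit r (proj₁ p)) → size (Decomposed m r k) (decompose-at p v) ≡ sum (proj₁ p)
      size-decompose (λs , _) (rowSplit t x rest _ t++x∷rest≡λs) = begin
        sum t + (x + (sum mid + sum bot))   ≡⟨ cong (λ s → sum t + (x + s)) (sum-++ mid bot) ⟨
        sum t + (x + sum (mid ++ bot))      ≡⟨ sum-++ t (x ∷ mid ++ bot) ⟨
        sum (t ++ x ∷ mid ++ bot)           ≡⟨ cong sum (trans (cong (λ ys → t ++ x ∷ ys) (split≥-++ m rest)) t++x∷rest≡λs) ⟩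
        sum λs                              ∎
        where
        open ≡-Reasoning
        mid bot : List ℕ
        mid = proj₁ (split≥ m rest)
        bot = proj₂ (split≥ m rest)

    HookPartitions-≅ : HookPartitions m (suc r) k ≅ Decomposed m r k
    HookPartitions-≅ = mk≅
      (mk↔ₛ′ (λ p → decompose-at p (row-of p)) assemble (λ s → decompose∘assemble s (row-of (assemble s)))
             (λ p → assemble∘decompose p (row-of p)))
      (λ p → size-decompose p (row-of p))

-- The part in row s = r + 1 is x = l + m − 1, so l − 1 is the arm and k − l the leg of the hook; m₀ = 1 + 2j
-- is the least odd number ≥ m, and the parity of m enters only through c = m₀ − (m − 1) ∈ {1, 2}.
module GroupByArm
  (m′ j c k r : ℕ) (c+m′≡1+2j : c Nat.+ m′ ≡ 1 Nat.+ 2 Nat.* j) (1≤c : 1 Nat.≤ c) (c≤2 : c Nat.≤ 2)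
  (P : ℕ → Set) (P-irrelevant : ∀ {l} (p q : P l) → p ≡ q)
  (P-intro : ∀ N → 2 Nat.* N Nat.+ c Nat.≤ k → k Nat.∸ (2 Nat.* N Nat.+ c) Nat.≤ N → P (2 Nat.* N Nat.+ c))
  (P-elim : ∀ {l} → P l → Σ ℕ λ N → l ≡ 2 Nat.* N Nat.+ c)
  where

  open import Defs
  open import Data.Nat using (suc; _+_; _*_; _∸_; _<_; _≤_; z≤n; s≤s; _≟_)
  import Data.Nat.Properties as ℕₚ
  open import Data.Nat.DivMod using (_/_; m*n/n≡m)
  open import Data.Nat.Tactic.RingSolver using (solve-∀)
  open import Data.Nat.ListAction using (sum)
  import Data.Integer as ℤ
  open import Data.Integer using (1ℤ)
  open import Data.Product using (_,_; proj₁; proj₂)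
  open import Data.List using (length; upTo; filter)
  open import Data.Unit using (tt)
  open import Function using (id)
  open import Function.Bundles using (Inverse; mk↔ₛ′)
  open import Relation.Nullary using (yes; no)
  open import Relation.Unary using (Decidable)
  open import Relation.Binary.PropositionalEquality
  open import Algebra.Bundles using (CommutativeRing)
  open PowerSeries using (PS-commutativeRing; qᶻ-+)
  open CommutativeRing PS-commutativeRing using () renaming (sym to ≈-sym)
  open Classes
  open OddChains
  open OddPartClasses
  open HookRowSplit using (Shape; HookShape; HookShape-irrelevant; Decomposed; HookPartitions; HookPartitions-≅)

  m m₀ : ℕ
  m  = suc m′
  m₀ = 1 + 2 * j

  half : ℕ → ℕ
  half l = (l ∸ c) / 2

  half-2*+ : ∀ N → half (2 * N + c) ≡ N
  half-2*+ N = trans (cong (_/ 2) (trans (ℕₚ.m+n∸n≡m (2 * N) c) (ℕₚ.*-comm 2 N))) (m*n/n≡m N 2)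

  private
    odd-m₀ : Odd m₀
    odd-m₀ = odd-1+2* j

    m≤m₀ : m ≤ m₀
    m≤m₀ = subst (m ≤_) c+m′≡1+2j (ℕₚ.+-monoˡ-≤ m′ 1≤c)

    2j≤m : 2 * j ≤ m
    2j≤m = ℕₚ.+-cancelˡ-≤ 1 (2 * j) m (subst (_≤ 2 + m′) c+m′≡1+2j (ℕₚ.+-monoˡ-≤ m′ c≤2))

    odd-below-m : ∀ {y} → Odd y → y < m → y < 2 * j
    odd-below-m {y} odd-y y<m = ℕₚ.≤∧≢⇒< (ℕₚ.≤-pred (ℕₚ.<-≤-trans y<m m≤m₀)) λ { refl → even-¬odd j odd-y }

    below-2j : ∀ {y} → Odd y → y < 2 * j → y < m
    below-2j _ y<2j = ℕₚ.<-≤-trans y<2j 2j≤m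

    odd-above-m : ∀ {y} → Odd y → m ≤ y → m₀ ≤ y
    odd-above-m {y} odd-y m≤y = ℕₚ.≤∧≢⇒< (ℕₚ.≤-trans 2j≤m m≤y) λ { refl → even-¬odd j odd-y }

    odd-from-m₀ : ∀ {x} → Odd x → m₀ ≤ x → Σ ℕ λ N → x ≡ 2 * N + m₀
    odd-from-m₀ {x} odd-x m₀≤x with m₀ ≟ x
    ... | yes refl = 0 , refl
    ... | no m₀≢x  = let d , x≡ = odd-gap odd-m₀ odd-x (ℕₚ.≤∧≢⇒< m₀≤x m₀≢x) in suc d , trans x≡ (shift d m₀)
      where
      shift : ∀ d m₀ → 2 + 2 * d + m₀ ≡ 2 * suc d + m₀
      shift = solve-∀

    arm-row : ∀ N → 2 * N + c + m′ ≡ 2 * N + m₀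
    arm-row N = trans (ℕₚ.+-assoc (2 * N) c m′) (cong (2 * N +_) c+m′≡1+2j)

    arm+m′≡ : ∀ {x} (odd-x : Odd x) (m≤x : m ≤ x) → 2 * proj₁ (odd-from-m₀ odd-x (odd-above-m odd-x m≤x)) + c + m′ ≡ x
    arm+m′≡ {x} odd-x m≤x = trans (arm-row N) (sym (proj₂ (odd-from-m₀ odd-x (odd-above-m odd-x m≤x))))
      where
      N : ℕ
      N = proj₁ (odd-from-m₀ odd-x (odd-above-m odd-x m≤x))

  ArmBlocks : ℕ → Class
  ArmBlocks l = pt (l + m′) ⊗ OddPartsAbove (l + m′) 0 r ⊗ OddPartsBetween m₀ (half l) (k ∸ l) ⊗ OddPartsBelow (2 * j)

  ByArm : Class
  ByArm = ⨁< (suc k) λ l → guard (P l) (ArmBlocks l)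

  private
    ByArm-≡ : ∀ {l l′ l< l<′ p p′ t t′ a a′ mid mid′ b b′ bot bot′ d d′} →
      l ≡ l′ → t ≡ t′ → mid ≡ mid′ → bot ≡ bot′ →
      _≡_ {A = Obj ByArm} (l , l< , p , tt , (t , a) , (mid , b) , (bot , d)) (l′ , l<′ , p′ , tt , (t′ , a′) , (mid′ , b′) , (bot′ , d′))
    ByArm-≡ {l} {l< = l<} {l<′} {p} {p′} {t} {a = a} {a′} {mid} {b = b} {b′} {bot} {d = d} {d′} refl refl refl refl =
      cong₂ (λ u v → l , u , v) (ℕₚ.≤-irrelevant l< l<′)
        (cong₂ (λ u v → u , tt , v) (P-irrelevant p p′)
          (cong₂ (λ u v → (t , u) , v) (×-irrelevant (OddAbove-irrelevant t) ℕₚ.≡-irrelevant a a′)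
            (cong₂ (λ u v → (mid , u) , (bot , v)) (×-irrelevant (OddChain-irrelevant mid) ℕₚ.≡-irrelevant b b′)
                                                   (OddChain-irrelevant bot d d′))))

    group : Σ Shape (HookShape m r k) → Obj ByArm
    group ((t , x , mid , bot) , above , |t|≡r , odd-x , m≤x , c-mid , c-bot , hook≡) =
      l , s≤s l≤k , P-intro N l≤k (subst (_≤ N) (sym k∸l≡L) L≤N) , tt
        , (t , subst (λ y → OddAbove y t) (sym l+m′≡x) above , |t|≡r)
        , (mid , subst (λ n → OddChain m₀ (2 * n + m₀) mid) (sym (half-2*+ N)) c-mid′ , sym k∸l≡L)
        , (bot , OddChain-mapʳ bot odd-below-m c-bot)
      where
      N l L : ℕ
      N = proj₁ (odd-from-m₀ odd-x (odd-above-m odd-x m≤x))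
      l = 2 * N + c
      L = length mid
      x≡ : x ≡ 2 * N + m₀
      x≡ = proj₂ (odd-from-m₀ odd-x (odd-above-m odd-x m≤x))
      l+m′≡x : l + m′ ≡ x
      l+m′≡x = arm+m′≡ odd-x m≤x
      l+L≡k : l + L ≡ k
      l+L≡k = ℕₚ.+-cancelˡ-≡ m′ (l + L) k (ℕₚ.suc-injective (trans (regroup l m′ L) (trans (cong (_+ suc L) l+m′≡x) hook≡)))
        where
        regroup : ∀ l m′ L → suc (m′ + (l + L)) ≡ l + m′ + suc L
        regroup = solve-∀
      l≤k : l ≤ k
      l≤k = subst (l ≤_) l+L≡k (ℕₚ.m≤m+n l L)
      k∸l≡L : k ∸ l ≡ L
      k∸l≡L = trans (cong (_∸ l) (sym l+L≡k)) (ℕₚ.m+n∸m≡n l L)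
      c-mid′ : OddChain m₀ (2 * N + m₀) mid
      c-mid′ = subst (λ y → OddChain m₀ y mid) x≡ (OddChain-mapˡ mid odd-above-m c-mid)
      L≤N : L ≤ N
      L≤N = Pascal-bound N L (proj₂ (Inverse.to (bijection (OddPartsBetween-≅ odd-m₀ N L)) (mid , c-mid′ , refl)))

    row≡ : ∀ {l} (p : P l) → l + m′ ≡ 2 * proj₁ (P-elim p) + m₀
    row≡ p = trans (cong (_+ m′) (proj₂ (P-elim p))) (arm-row (proj₁ (P-elim p)))

    odd-row : ∀ {l} → P l → Odd (l + m′)
    odd-row p = subst Odd (sym (row≡ p)) (odd-2*+ (proj₁ (P-elim p)) odd-m₀)

    m≤row : ∀ {l} → P l → m ≤ l + m′
    m≤row p = ℕₚ.≤-trans m≤m₀ (subst (m₀ ≤_) (sym (row≡ p)) (ℕₚ.m≤n+m m₀ (2 * proj₁ (P-elim p))))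

    ungroup : Obj ByArm → Σ Shape (HookShape m r k)
    ungroup (l , s≤s l≤k , p , tt , (t , above , |t|≡r) , (mid , c-mid , |mid|≡k∸l) , (bot , c-bot)) =
      (t , l + m′ , mid , bot) , above , |t|≡r , odd-row p , m≤row p , c-mid′ , OddChain-mapʳ bot below-2j c-bot , hook≡
      where
      c-mid′ : OddChain m (l + m′) mid
      c-mid′ = OddChain-weakenˡ mid m≤m₀ (subst (λ y → OddChain m₀ y mid)
                 (trans (cong (λ n → 2 * n + m₀) (trans (cong half (proj₂ (P-elim p))) (half-2*+ (proj₁ (P-elim p))))) (sym (row≡ p))) c-mid)
      hook≡ : l + m′ + suc (length mid) ≡ m + k
      hook≡ = trans (cong (λ L → l + m′ + suc L) |mid|≡k∸l) (trans (regroup l m′ (k ∸ l)) (cong (suc m′ +_) (ℕₚ.m+[n∸m]≡n l≤k)))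
        where
        regroup : ∀ l m′ L → l + m′ + suc L ≡ suc m′ + (l + L)
        regroup = solve-∀

    group∘ungroup : ∀ b → group (ungroup b) ≡ b
    group∘ungroup (l , s≤s l≤k , p , tt , (t , above , |t|≡r) , (mid , c-mid , |mid|≡k∸l) , (bot , c-bot)) = ByArm-≡ same-l refl refl refl
      where
      same-l : 2 * proj₁ (odd-from-m₀ (odd-row p) (odd-above-m (odd-row p) (m≤row p))) + c ≡ l
      same-l = ℕₚ.+-cancelʳ-≡ m′ _ l (arm+m′≡ (odd-row p) (m≤row p))

    ungroup∘group : ∀ s → ungroup (group s) ≡ s
    ungroup∘group ((t , x , mid , bot) , above , |t|≡r , odd-x , m≤x , c-mid , c-bot , hook≡) =
      subtype-≡ (HookShape-irrelevant _) (cong (λ y → t , y , mid , bot) (arm+m′≡ odd-x m≤x))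

    size-group : ∀ s → size ByArm (group s) ≡ size (Decomposed m r k) s
    size-group ((t , x , mid , bot) , above , |t|≡r , odd-x , m≤x , c-mid , c-bot , hook≡) =
      trans (cong (λ y → y + ((sum t + 0) + (sum mid + sum bot))) (arm+m′≡ odd-x m≤x)) (regroup x (sum t) (sum mid) (sum bot))
      where
      regroup : ∀ x T M B → x + ((T + 0) + (M + B)) ≡ T + (x + (M + B))
      regroup = solve-∀

  Decomposed-≅ : Decomposed m r k ≅ ByArm
  Decomposed-≅ = mk≅ (mk↔ₛ′ group ungroup group∘ungroup ungroup∘group) size-group

  exponent : ℕ → ℕ
  exponent l = (l + m′) + (offset-above 0 r (l + m′) + offset-between m₀ (k ∸ l))

  Term : ℕ → Class
  Term l = ((pt (exponent l) ⊗ OddPartsBelow (2 * j)) ⊗ GapProduct 0 r) ⊗ Pascal (half l) (k ∸ l)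

  ArmBlocks-≅ : ∀ {l} → P l → ArmBlocks l ≅ Term l
  ArmBlocks-≅ {l} p =
    ≅-trans (⊗-cong (≅-refl {pt (l + m′)})
              (⊗-cong (OddPartsAbove-≅ odd-x r 0) (⊗-cong (OddPartsBetween-≅ odd-m₀ (half l) (k ∸ l)) ≅-refl)))
            (mk≅ (mk↔ₛ′ (λ (_ , (_ , g) , (_ , s) , b) → ((tt , b) , g) , s) (λ (((_ , b) , g) , s) → tt , (tt , g) , (tt , s) , b)
                        (λ _ → refl) (λ _ → refl))
                 (λ (_ , (_ , g) , (_ , s) , b) → regroup (l + m′) (offset-above 0 r (l + m′)) (offset-between m₀ (k ∸ l))
                                                          (size (GapProduct 0 r) g) (size (Pascal (half l) (k ∸ l)) s)
                                                          (size (OddPartsBelow (2 * j)) b)))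
    where
    odd-x : Odd (l + m′)
    odd-x = let N , l≡ = P-elim p in subst Odd (sym (trans (cong (_+ m′) l≡) (arm-row N))) (odd-2*+ N odd-m₀)
    regroup : ∀ x a b g s d → ((x + (a + b) + d) + g) + s ≡ x + ((a + g) + ((b + s) + d))
    regroup = solve-∀

  ByArm-≅ : ByArm ≅ ⨁< (suc k) λ l → guard (P l) (Term l)
  ByArm-≅ = mk≅ (mk↔ₛ′ (λ (l , l< , p , b) → l , l< , p , Inverse.to (bijection (ArmBlocks-≅ p)) b)
                       (λ (l , l< , p , b) → l , l< , p , Inverse.from (bijection (ArmBlocks-≅ p)) b)
                       (λ (l , l< , p , b) → cong (λ b′ → l , l< , p , b′) (Inverse.strictlyInverseˡ (bijection (ArmBlocks-≅ p)) b))
                       (λ (l , l< , p , b) → cong (λ b′ → l , l< , p , b′) (Inverse.strictlyInverseʳ (bijection (ArmBlocks-≅ p)) b)))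
                (λ (l , l< , p , b) → size-preserving (ArmBlocks-≅ p) b)

  counts-HookPartitions : (P? : Decidable P) (F : ℕ → PS) → (∀ l → l ≤ k → P l → F l counts Term l) →
                          Σₚ (filter P? (upTo (suc k))) F counts HookPartitions m (suc r) k
  counts-HookPartitions P? F counts-term =
    counts-≅ (counts-Σₚ-filter P? P-irrelevant (suc k) id (λ l l<1+k → counts-term l (ℕₚ.≤-pred l<1+k)))
             (≅-sym (≅-trans (HookPartitions-≅ (s≤s z≤n) r k) (≅-trans Decomposed-≅ ByArm-≅)))

  counts-summand : ∀ {l e i t a b} → e ≡ ℤ.+ exponent l → i ≡ j → t ≡ r → a ≡ ℤ.+ half l → b ≡ ℤ.+ (k ∸ l) →
    qᶻ e *ₚ qpoch (ℤ.- 1ℤ) 1 2 i *ₚ q2q2Inv t *ₚ gauss2 a b counts Term l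
  counts-summand {l} refl refl refl refl refl =
    counts-* (counts-* (counts-* (counts-≈ (≈-sym (qᶻ-+ (exponent l))) (counts-pt (exponent l))) (counts-OddPartsBelow j))
                       (counts-GapProduct r))
             (counts-Pascal (half l) (k ∸ l))

module SummandArithmetic where

  open import Defs
  open import Data.Nat using (zero; suc; _+_; _*_; _∸_; _≤_; s≤s)
  import Data.Nat as ℕ
  import Data.Nat.Properties as ℕₚ
  open import Data.Nat.DivMod using (m*n/n≡m)
  open import Data.Integer as ℤ using (ℤ; +_; 0ℤ; 1ℤ)
  import Data.Integer.Properties as ℤₚ
  open import Data.Integer.DivMod using (div-pos-is-/ℕ) renaming (_/_ to _/ℤ_)
  open import Data.Integer.Tactic.RingSolver using (solve-∀)
  open import Data.Product using (_,_)
  open import Data.Sum using (inj₁; inj₂)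
  open import Relation.Binary.PropositionalEquality
  open OddPartClasses using (offset-above; offset-between)
  open ≡-Reasoning

  +-∸ : ∀ {k l} → l ≤ k → + k ℤ.- + l ≡ + (k ∸ l)
  +-∸ {k} {l} l≤k = trans (ℤₚ.m-n≡m⊖n k l) (ℤₚ.⊖-≥ l≤k)

  double/2 : ∀ t → (+ 2 ℤ.* + t) /ℤ + 2 ≡ + t
  double/2 t = begin
    (+ 2 ℤ.* + t) /ℤ + 2     ≡⟨ cong (_/ℤ + 2) (sym (ℤₚ.pos-* 2 t)) ⟩
    + (2 * t) /ℤ + 2         ≡⟨ div-pos-is-/ℕ (+ (2 * t)) 2 ⟩
    + ((2 * t) ℕ./ 2)        ≡⟨ cong (λ n → + (n ℕ./ 2)) (ℕₚ.*-comm 2 t) ⟩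
    + ((t * 2) ℕ./ 2)        ≡⟨ cong +_ (m*n/n≡m t 2) ⟩
    + t                      ∎

  2*choose2 : ∀ a → + 2 ℤ.* choose2 (+ a) ≡ + a ℤ.* (+ a ℤ.- 1ℤ)
  2*choose2 a = let t , a[a-1]≡2t = even a in
    trans (cong (λ x → + 2 ℤ.* (x /ℤ + 2)) a[a-1]≡2t) (trans (cong (+ 2 ℤ.*_) (double/2 t)) (sym a[a-1]≡2t))
    where
    even : ∀ a → Σ ℕ λ t → + a ℤ.* (+ a ℤ.- 1ℤ) ≡ + 2 ℤ.* + t
    even zero    = 0 , refl
    even (suc a) = let t , a[a-1]≡2t = even a in
      t + a , trans (step (+ a)) (trans (cong (ℤ._+ + 2 ℤ.* + a) a[a-1]≡2t) (collect (+ t) (+ a)))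
      where
      step : ∀ A → (1ℤ ℤ.+ A) ℤ.* ((1ℤ ℤ.+ A) ℤ.- 1ℤ) ≡ A ℤ.* (A ℤ.- 1ℤ) ℤ.+ + 2 ℤ.* A
      step = solve-∀
      collect : ∀ T A → + 2 ℤ.* T ℤ.+ + 2 ℤ.* A ≡ + 2 ℤ.* (T ℤ.+ A)
      collect = solve-∀

  private
    expo-expanded : ∀ m′ l L r → expo (suc m′) (l + L) (+ (l + L) ℤ.- + suc r) l ≡
      + m′ ℤ.* (+ L ℤ.+ + r ℤ.+ 1ℤ) ℤ.+ (+ l ℤ.+ + L) ℤ.+ + l ℤ.* + r ℤ.+ (+ r ℤ.+ 1ℤ) ℤ.* + r ℤ.+ + L ℤ.* (+ L ℤ.- 1ℤ)
    expo-expanded m′ l L r = begin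
      expo (suc m′) (l + L) h l
        ≡⟨ cong₂ (λ u v → (+ suc m′ ℤ.- 1ℤ) ℤ.* (+ 2 ℤ.* + (l + L) ℤ.- h ℤ.- + l) ℤ.+ + (l + L) ℤ.+ + l ℤ.* (+ (l + L) ℤ.- h ℤ.- 1ℤ)
                          ℤ.+ u ℤ.+ v)
                 (trans (cong (λ x → + 2 ℤ.* choose2 x) (k-h≡ (+ l) (+ L) (+ r))) (2*choose2 (suc r)))
                 (trans (cong (λ x → + 2 ℤ.* choose2 x) (k-l≡ (+ l) (+ L))) (2*choose2 L)) ⟩
      (+ suc m′ ℤ.- 1ℤ) ℤ.* (+ 2 ℤ.* + (l + L) ℤ.- h ℤ.- + l) ℤ.+ + (l + L) ℤ.+ + l ℤ.* (+ (l + L) ℤ.- h ℤ.- 1ℤ)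
        ℤ.+ + suc r ℤ.* (+ suc r ℤ.- 1ℤ) ℤ.+ + L ℤ.* (+ L ℤ.- 1ℤ)
        ≡⟨ polynomial (+ m′) (+ l) (+ L) (+ r) ⟩
      + m′ ℤ.* (+ L ℤ.+ + r ℤ.+ 1ℤ) ℤ.+ (+ l ℤ.+ + L) ℤ.+ + l ℤ.* + r ℤ.+ (+ r ℤ.+ 1ℤ) ℤ.* + r ℤ.+ + L ℤ.* (+ L ℤ.- 1ℤ)
        ∎
      where
      h : ℤ
      h = + (l + L) ℤ.- + suc r
      k-h≡ : ∀ l L r → (l ℤ.+ L) ℤ.- ((l ℤ.+ L) ℤ.- (1ℤ ℤ.+ r)) ≡ 1ℤ ℤ.+ r
      k-h≡ = solve-∀
      k-l≡ : ∀ l L → (l ℤ.+ L) ℤ.- l ≡ L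
      k-l≡ = solve-∀
      polynomial : ∀ M l L r →
        (1ℤ ℤ.+ M ℤ.- 1ℤ) ℤ.* (+ 2 ℤ.* (l ℤ.+ L) ℤ.- ((l ℤ.+ L) ℤ.- (1ℤ ℤ.+ r)) ℤ.- l) ℤ.+ (l ℤ.+ L)
          ℤ.+ l ℤ.* ((l ℤ.+ L) ℤ.- ((l ℤ.+ L) ℤ.- (1ℤ ℤ.+ r)) ℤ.- 1ℤ) ℤ.+ (1ℤ ℤ.+ r) ℤ.* ((1ℤ ℤ.+ r) ℤ.- 1ℤ) ℤ.+ L ℤ.* (L ℤ.- 1ℤ)
        ≡ M ℤ.* (L ℤ.+ r ℤ.+ 1ℤ) ℤ.+ (l ℤ.+ L) ℤ.+ l ℤ.* r ℤ.+ (r ℤ.+ 1ℤ) ℤ.* r ℤ.+ L ℤ.* (L ℤ.- 1ℤ)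
      polynomial = solve-∀

    exponent-expanded : ∀ x r m₀ L → + (x + (offset-above 0 r x + offset-between m₀ L)) ≡
      + x ℤ.+ ((+ r ℤ.* + x ℤ.+ + r ℤ.* (+ r ℤ.+ 1ℤ)) ℤ.+ (+ L ℤ.* + m₀ ℤ.+ + L ℤ.* (+ L ℤ.- 1ℤ)))
    exponent-expanded x r m₀ L = begin
      + x ℤ.+ ((+ ((r + 0) * x) ℤ.+ + (r * (r + 1)) ℤ.+ 0ℤ) ℤ.+ (+ (L * m₀) ℤ.+ + (L * (L ∸ 1))))
        ≡⟨ cong₂ (λ u v → + x ℤ.+ (u ℤ.+ v))
                 (trans (ℤₚ.+-identityʳ _) (cong₂ ℤ._+_ (trans (cong (λ t → + (t * x)) (ℕₚ.+-identityʳ r)) (ℤₚ.pos-* r x))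
                                                      (ℤₚ.pos-* r (r + 1))))
                 (cong₂ ℤ._+_ (ℤₚ.pos-* L m₀) (pred-product L)) ⟩
      + x ℤ.+ ((+ r ℤ.* + x ℤ.+ + r ℤ.* (+ r ℤ.+ 1ℤ)) ℤ.+ (+ L ℤ.* + m₀ ℤ.+ + L ℤ.* (+ L ℤ.- 1ℤ)))
        ∎
      where
      pred-product : ∀ L → + (L * (L ∸ 1)) ≡ + L ℤ.* (+ L ℤ.- 1ℤ)
      pred-product zero    = refl
      pred-product (suc L) = trans (ℤₚ.pos-* (suc L) L) (cong (+ suc L ℤ.*_) (sym (cancel (+ L))))
        where
        cancel : ∀ A → (1ℤ ℤ.+ A) ℤ.- 1ℤ ≡ A
        cancel = solve-∀

  expo-odd : ∀ j r {k l} → l ≤ k → expo (suc (2 * j)) k (+ k ℤ.- + suc r) l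
             ≡ + ((l + 2 * j) + (offset-above 0 r (l + 2 * j) + offset-between (1 + 2 * j) (k ∸ l)))
  expo-odd j r {l = l} l≤k with ℕₚ.m≤n⇒∃[o]m+o≡n l≤k
  ... | L , refl = begin
    expo (suc (2 * j)) (l + L) (+ (l + L) ℤ.- + suc r) l
      ≡⟨ expo-expanded (2 * j) l L r ⟩
    + (2 * j) ℤ.* (+ L ℤ.+ + r ℤ.+ 1ℤ) ℤ.+ (+ l ℤ.+ + L) ℤ.+ + l ℤ.* + r ℤ.+ (+ r ℤ.+ 1ℤ) ℤ.* + r ℤ.+ + L ℤ.* (+ L ℤ.- 1ℤ)
      ≡⟨ polynomial (+ (2 * j)) (+ l) (+ L) (+ r) ⟩
    + (l + 2 * j) ℤ.+ ((+ r ℤ.* + (l + 2 * j) ℤ.+ + r ℤ.* (+ r ℤ.+ 1ℤ)) ℤ.+ (+ L ℤ.* + (1 + 2 * j) ℤ.+ + L ℤ.* (+ L ℤ.- 1ℤ)))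
      ≡⟨ exponent-expanded (l + 2 * j) r (1 + 2 * j) L ⟨
    + ((l + 2 * j) + (offset-above 0 r (l + 2 * j) + offset-between (1 + 2 * j) L))
      ≡⟨ cong (λ L′ → + ((l + 2 * j) + (offset-above 0 r (l + 2 * j) + offset-between (1 + 2 * j) L′))) (ℕₚ.m+n∸m≡n l L) ⟨
    + ((l + 2 * j) + (offset-above 0 r (l + 2 * j) + offset-between (1 + 2 * j) (l + L ∸ l)))
      ∎
    where
    polynomial : ∀ M l L r → M ℤ.* (L ℤ.+ r ℤ.+ 1ℤ) ℤ.+ (l ℤ.+ L) ℤ.+ l ℤ.* r ℤ.+ (r ℤ.+ 1ℤ) ℤ.* r ℤ.+ L ℤ.* (L ℤ.- 1ℤ)
      ≡ (l ℤ.+ M) ℤ.+ ((r ℤ.* (l ℤ.+ M) ℤ.+ r ℤ.* (r ℤ.+ 1ℤ)) ℤ.+ (L ℤ.* (1ℤ ℤ.+ M) ℤ.+ L ℤ.* (L ℤ.- 1ℤ)))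
    polynomial = solve-∀

  expo-even : ∀ j r {k l} → l ≤ k → + k ℤ.- + l ℤ.+ expo (suc (1 + 2 * j)) k (+ k ℤ.- + suc r) l
              ≡ + ((l + (1 + 2 * j)) + (offset-above 0 r (l + (1 + 2 * j)) + offset-between (2 + (1 + 2 * j)) (k ∸ l)))
  expo-even j r {l = l} l≤k with ℕₚ.m≤n⇒∃[o]m+o≡n l≤k
  ... | L , refl = begin
    + (l + L) ℤ.- + l ℤ.+ expo (suc (1 + 2 * j)) (l + L) (+ (l + L) ℤ.- + suc r) l
      ≡⟨ cong (ℤ._+_ (+ (l + L) ℤ.- + l)) (expo-expanded (1 + 2 * j) l L r) ⟩
    + (l + L) ℤ.- + l ℤ.+ (+ (1 + 2 * j) ℤ.* (+ L ℤ.+ + r ℤ.+ 1ℤ) ℤ.+ (+ l ℤ.+ + L) ℤ.+ + l ℤ.* + r ℤ.+ (+ r ℤ.+ 1ℤ) ℤ.* + r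
                            ℤ.+ + L ℤ.* (+ L ℤ.- 1ℤ))
      ≡⟨ polynomial (+ (1 + 2 * j)) (+ l) (+ L) (+ r) ⟩
    + (l + (1 + 2 * j)) ℤ.+ ((+ r ℤ.* + (l + (1 + 2 * j)) ℤ.+ + r ℤ.* (+ r ℤ.+ 1ℤ))
                             ℤ.+ (+ L ℤ.* + (2 + (1 + 2 * j)) ℤ.+ + L ℤ.* (+ L ℤ.- 1ℤ)))
      ≡⟨ exponent-expanded (l + (1 + 2 * j)) r (2 + (1 + 2 * j)) L ⟨
    + ((l + (1 + 2 * j)) + (offset-above 0 r (l + (1 + 2 * j)) + offset-between (2 + (1 + 2 * j)) L))
      ≡⟨ cong (λ L′ → + ((l + (1 + 2 * j)) + (offset-above 0 r (l + (1 + 2 * j)) + offset-between (2 + (1 + 2 * j)) L′)))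
              (ℕₚ.m+n∸m≡n l L) ⟨
    + ((l + (1 + 2 * j)) + (offset-above 0 r (l + (1 + 2 * j)) + offset-between (2 + (1 + 2 * j)) (l + L ∸ l)))
      ∎
    where
    polynomial : ∀ M l L r → (l ℤ.+ L) ℤ.- l ℤ.+ (M ℤ.* (L ℤ.+ r ℤ.+ 1ℤ) ℤ.+ (l ℤ.+ L) ℤ.+ l ℤ.* r ℤ.+ (r ℤ.+ 1ℤ) ℤ.* r ℤ.+ L ℤ.* (L ℤ.- 1ℤ))
      ≡ (l ℤ.+ M) ℤ.+ ((r ℤ.* (l ℤ.+ M) ℤ.+ r ℤ.* (r ℤ.+ 1ℤ)) ℤ.+ (L ℤ.* (+ 2 ℤ.+ M) ℤ.+ L ℤ.* (L ℤ.- 1ℤ)))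
    polynomial = solve-∀

  -- At the lower end of the summation range the leg is N + 1: then the Gaussian binomial vanishes,
  -- and its top argument involves the division (−2)/2.
  private
    top≡ : ∀ N L → L ≤ suc N → ∀ {a} → a ≡ + 2 ℤ.* (+ N ℤ.- + L) → + L ℤ.+ a /ℤ + 2 ≡ + N
    top≡ N L L≤1+N refl with ℕₚ.m≤n⇒m<n∨m≡n L≤1+N
    ... | inj₂ refl = trans (cong (λ z → + suc N ℤ.+ (+ 2 ℤ.* z) /ℤ + 2) (minus-one (+ N))) (plus-minus-one (+ N))
      where
      minus-one : ∀ N → N ℤ.- (1ℤ ℤ.+ N) ≡ ℤ.- 1ℤ
      minus-one = solve-∀
      plus-minus-one : ∀ N → (1ℤ ℤ.+ N) ℤ.+ ℤ.- 1ℤ ≡ N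
      plus-minus-one = solve-∀
    ... | inj₁ (s≤s L≤N) = begin
      + L ℤ.+ (+ 2 ℤ.* (+ N ℤ.- + L)) /ℤ + 2    ≡⟨ cong (λ z → + L ℤ.+ (+ 2 ℤ.* z) /ℤ + 2) (+-∸ L≤N) ⟩
      + L ℤ.+ (+ 2 ℤ.* + (N ∸ L)) /ℤ + 2        ≡⟨ cong (ℤ._+_ (+ L)) (double/2 (N ∸ L)) ⟩
      + (L + (N ∸ L))                           ≡⟨ cong +_ (ℕₚ.m+[n∸m]≡n L≤N) ⟩
      + N                                       ∎

    top-with-leg : ∀ N c {k} → 2 * N + c ≤ k → k ∸ (2 * N + c) ≤ suc N → ∀ {a} → a ≡ + 2 ℤ.* (+ N ℤ.- + (k ∸ (2 * N + c))) →
      + k ℤ.- + (2 * N + c) ℤ.+ a /ℤ + 2 ≡ + N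
    top-with-leg N c l≤k L≤1+N a≡ = trans (cong (ℤ._+ _) (+-∸ l≤k)) (top≡ N _ L≤1+N a≡)

    pos-2*+ : ∀ N c → + (2 * N + c) ≡ + 2 ℤ.* + N ℤ.+ + c
    pos-2*+ N c = cong (ℤ._+ + c) (ℤₚ.pos-* 2 N)

  top-odd : ∀ N {k} → 2 * N + 1 ≤ k → k ∸ (2 * N + 1) ≤ suc N →
            + k ℤ.- + (2 * N + 1) ℤ.+ (+ 3 ℤ.* + (2 * N + 1) ℤ.- + 2 ℤ.* + k ℤ.- 1ℤ) /ℤ + 2 ≡ + N
  top-odd N l≤k L≤1+N with ℕₚ.m≤n⇒∃[o]m+o≡n l≤k
  ... | L , refl = top-with-leg N 1 l≤k L≤1+N (begin
    + 3 ℤ.* + (2 * N + 1) ℤ.- + 2 ℤ.* (+ (2 * N + 1) ℤ.+ + L) ℤ.- 1ℤ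
      ≡⟨ cong (λ x → + 3 ℤ.* x ℤ.- + 2 ℤ.* (x ℤ.+ + L) ℤ.- 1ℤ) (pos-2*+ N 1) ⟩
    + 3 ℤ.* (+ 2 ℤ.* + N ℤ.+ 1ℤ) ℤ.- + 2 ℤ.* ((+ 2 ℤ.* + N ℤ.+ 1ℤ) ℤ.+ + L) ℤ.- 1ℤ
      ≡⟨ inner (+ N) (+ L) ⟩
    + 2 ℤ.* (+ N ℤ.- + L)
      ≡⟨ cong (λ L′ → + 2 ℤ.* (+ N ℤ.- + L′)) (ℕₚ.m+n∸m≡n (2 * N + 1) L) ⟨
    + 2 ℤ.* (+ N ℤ.- + (2 * N + 1 + L ∸ (2 * N + 1)))
      ∎)
    where
    inner : ∀ N L → + 3 ℤ.* (+ 2 ℤ.* N ℤ.+ 1ℤ) ℤ.- + 2 ℤ.* ((+ 2 ℤ.* N ℤ.+ 1ℤ) ℤ.+ L) ℤ.- 1ℤ ≡ + 2 ℤ.* (N ℤ.- L)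
    inner = solve-∀

  top-even : ∀ N {k} → 2 * N + 2 ≤ k → k ∸ (2 * N + 2) ≤ suc N →
             + k ℤ.- + (2 * N + 2) ℤ.+ (+ 3 ℤ.* + (2 * N + 2) ℤ.- + 2 ℤ.* + k ℤ.- + 2) /ℤ + 2 ≡ + N
  top-even N l≤k L≤1+N with ℕₚ.m≤n⇒∃[o]m+o≡n l≤k
  ... | L , refl = top-with-leg N 2 l≤k L≤1+N (begin
    + 3 ℤ.* + (2 * N + 2) ℤ.- + 2 ℤ.* (+ (2 * N + 2) ℤ.+ + L) ℤ.- + 2
      ≡⟨ cong (λ x → + 3 ℤ.* x ℤ.- + 2 ℤ.* (x ℤ.+ + L) ℤ.- + 2) (pos-2*+ N 2) ⟩
    + 3 ℤ.* (+ 2 ℤ.* + N ℤ.+ + 2) ℤ.- + 2 ℤ.* ((+ 2 ℤ.* + N ℤ.+ + 2) ℤ.+ + L) ℤ.- + 2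
      ≡⟨ inner (+ N) (+ L) ⟩
    + 2 ℤ.* (+ N ℤ.- + L)
      ≡⟨ cong (λ L′ → + 2 ℤ.* (+ N ℤ.- + L′)) (ℕₚ.m+n∸m≡n (2 * N + 2) L) ⟨
    + 2 ℤ.* (+ N ℤ.- + (2 * N + 2 + L ∸ (2 * N + 2)))
      ∎)
    where
    inner : ∀ N L → + 3 ℤ.* (+ 2 ℤ.* N ℤ.+ + 2) ℤ.- + 2 ℤ.* ((+ 2 ℤ.* N ℤ.+ + 2) ℤ.+ L) ℤ.- + 2 ≡ + 2 ℤ.* (N ℤ.- L)
    inner = solve-∀

module Assembly where

  open import Defs
  open import Data.Nat using (zero; suc; _+_; _*_; _∸_; _≤_; _≤?_; z≤n; s≤s; _%_)
  import Data.Nat as ℕ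
  import Data.Nat.Properties as ℕₚ
  open import Data.Nat.DivMod using (_/_; m*n/n≡m; /-monoˡ-≤; m*n%n≡0)
  import Data.Nat.Tactic.RingSolver as ℕ-Ring
  open import Data.Integer as ℤ using (ℤ; +_; -[1+_]; 1ℤ; ∣_∣)
  import Data.Integer.Properties as ℤₚ
  open import Data.Integer.DivMod using () renaming (_/_ to _/ℤ_)
  import Data.Integer.Tactic.RingSolver as ℤ-Ring
  open import Data.Product using (_×_; _,_; proj₁)
  open import Data.Sum using (_⊎_; inj₁; inj₂)
  open import Data.Bool using (if_then_else_)
  open import Data.Empty using (⊥-elim)
  open import Function.Bundles using (_↔_; mk↔ₛ′)
  open import Relation.Nullary using (¬_; yes; no)
  open import Relation.Nullary.Decidable using (_×-dec_; dec-true; dec-false)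
  open import Relation.Unary using (Decidable)
  open import Relation.Binary.PropositionalEquality
  open PowerSeries using (_≈_; coeffwise)
  open Classes
  open OddChains using (odd-1+2*; odd⇒1+2*; even-¬odd)
  open OddPartClasses using (offset-above; offset-between)
  open HookRowSplit using (HookPartitions)
  open SummandArithmetic

  private
    k-1≡ : ∀ K → (1ℤ ℤ.+ K) ℤ.- 1ℤ ≡ K
    k-1≡ = ℤ-Ring.solve-∀

    k-[k-1-a]≡ : ∀ A D → (1ℤ ℤ.+ (A ℤ.+ D)) ℤ.- (1ℤ ℤ.+ D) ≡ A
    k-[k-1-a]≡ = ℤ-Ring.solve-∀

    k-[k+1+a]≡ : ∀ K A → (1ℤ ℤ.+ K) ℤ.- (1ℤ ℤ.+ ((1ℤ ℤ.+ K) ℤ.+ A)) ≡ ℤ.- (1ℤ ℤ.+ A)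
    k-[k+1+a]≡ = ℤ-Ring.solve-∀

    k-[k-s]≡ : ∀ K S → K ℤ.- (K ℤ.- S) ≡ S
    k-[k-s]≡ = ℤ-Ring.solve-∀

  row-of : ∀ {k} → 1 ≤ k → ∀ h → h ℤ.≤ + k ℤ.- 1ℤ → Σ ℕ λ r → h ≡ + k ℤ.- + suc r
  row-of {suc k′} _ (+ a) a≤k′ with ℕₚ.m≤n⇒∃[o]m+o≡n (ℤₚ.drop‿+≤+ (subst (+ a ℤ.≤_) (k-1≡ (+ k′)) a≤k′))
  ... | d , refl = d , sym (k-[k-1-a]≡ (+ a) (+ d))
  row-of {suc k′} _ -[1+ a ] _ = suc k′ + a , sym (k-[k+1+a]≡ (+ k′) (+ a))

  |k-h| : ∀ k r → ∣ + k ℤ.- (+ k ℤ.- + suc r) ∣ ≡ suc r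
  |k-h| k r = cong ∣_∣ (k-[k-s]≡ (+ k) (+ suc r))

  |k-h-1| : ∀ k r → ∣ + k ℤ.- (+ k ℤ.- + suc r) ℤ.- 1ℤ ∣ ≡ r
  |k-h-1| k r = cong ∣_∣ (trans (cong (ℤ._- 1ℤ) (k-[k-s]≡ (+ k) (+ suc r))) (k-1≡ (+ r)))

  Counted↔HookPartitions : ∀ m k h n {r} → ∣ + k ℤ.- h ∣ ≡ suc r → Counted m k h n ↔ HookPartitions m (suc r) k of-size n
  Counted↔HookPartitions m k h n s≡1+r with ∣ + k ℤ.- h ∣
  ... | _ with refl ← s≡1+r =
    mk↔ₛ′ (λ (λs , (linked , odd , sum≡n) , m≤part , hook≡) → (λs , (linked , odd) , m≤part , hook≡) , sum≡n)
          (λ ((λs , (linked , odd) , m≤part , hook≡) , sum≡n) → λs , (linked , odd , sum≡n) , m≤part , hook≡)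
          (λ _ → refl) (λ _ → refl)

  ceil3-≤ : ∀ a l → a + 2 ≤ 3 * l → ceil3 a ≤ l
  ceil3-≤ a l a+2≤3l = subst (ceil3 a ≤_) (trans (cong (_/ 3) (ℕₚ.*-comm 3 l)) (m*n/n≡m l 3)) (/-monoˡ-≤ 3 a+2≤3l)

  ≤-ceil3 : ∀ a b → 3 * b ≤ a + 2 → b ≤ ceil3 a
  ≤-ceil3 a b 3b≤a+2 = subst (_≤ ceil3 a) (trans (cong (_/ 3) (ℕₚ.*-comm 3 b)) (m*n/n≡m b 3)) (/-monoˡ-≤ 3 3b≤a+2)

  ceil3-≤⁻ : ∀ a l → ceil3 a ≤ l → a ≤ 3 * l
  ceil3-≤⁻ a l ceil≤l with a ≤? 3 * l
  ... | yes a≤3l = a≤3l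
  ... | no  a≰3l = ⊥-elim (ℕₚ.<⇒≱ (≤-ceil3 a (suc l) (subst (_≤ a + 2) (shift l) (ℕₚ.+-monoˡ-≤ 2 (ℕₚ.≰⇒> a≰3l)))) ceil≤l)
    where
    shift : ∀ l → suc (3 * l) + 2 ≡ 3 * suc l
    shift = ℕ-Ring.solve-∀

  ∸1+2 : ∀ {a} → 1 ≤ a → a ∸ 1 + 2 ≡ a + 1
  ∸1+2 {a} 1≤a = trans (ℕₚ.+-suc (a ∸ 1) 1) (trans (cong suc (ℕₚ.m∸n+n≡m 1≤a)) (ℕₚ.+-comm 1 a))

  1≤2* : ∀ {a} → 1 ≤ a → 1 ≤ 2 * a
  1≤2* {a} 1≤a = ℕₚ.≤-trans 1≤a (ℕₚ.m≤m+n a (a + 0))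

  halve-≤ : ∀ {x y} c {a b} → a ≤ b → a ≡ c + 2 * x → b ≡ c + 2 * y → x ≤ y
  halve-≤ c a≤b refl refl = ℕₚ.*-cancelˡ-≤ 2 (ℕₚ.+-cancelˡ-≤ c _ _ a≤b)

  parity : ∀ n → (Σ ℕ λ j → n ≡ 2 * j) ⊎ (Σ ℕ λ j → n ≡ 1 + 2 * j)
  parity zero          = inj₁ (0 , refl)
  parity (suc zero)    = inj₂ (0 , refl)
  parity (suc (suc n)) with parity n
  ... | inj₁ (j , refl) = inj₁ (suc j , shift j)
    where
    shift : ∀ j → 2 + 2 * j ≡ 2 * suc j
    shift = ℕ-Ring.solve-∀
  ... | inj₂ (j , refl) = inj₂ (suc j , shift j)
    where
    shift : ∀ j → 2 + (1 + 2 * j) ≡ 1 + 2 * suc j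
    shift = ℕ-Ring.solve-∀

  module OddColumn (j k r : ℕ) where

    h : ℤ
    h = + k ℤ.- + suc r

    -- For l = 2N + 1, the lower limit ⌈(2k − 1)/3⌉ ≤ l says that the leg k − l is at most N + 1.
    P : ℕ → Set
    P l = ceil3 (2 * k ∸ 1) ≤ l × l % 2 ≡ 1

    P? : Decidable P
    P? l = (ceil3 (2 * k ∸ 1) ≤? l) ×-dec (l % 2 ℕ.≟ 1)

    P-irrelevant : ∀ {l} (p q : P l) → p ≡ q
    P-irrelevant = ×-irrelevant ℕₚ.≤-irrelevant ℕₚ.≡-irrelevant

    P-elim : ∀ {l} → P l → Σ ℕ λ N → l ≡ 2 * N + 1
    P-elim {l} (_ , odd-l) = let N , l≡ = odd⇒1+2* {l} odd-l in N , trans l≡ (ℕₚ.+-comm 1 (2 * N))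

    private
      1≤2k : ∀ {N} → 2 * N + 1 ≤ k → 1 ≤ 2 * k
      1≤2k {N} l≤k = 1≤2* (ℕₚ.≤-trans (ℕₚ.m≤n+m 1 (2 * N)) l≤k)

    P-intro : ∀ N → 2 * N + 1 ≤ k → k ∸ (2 * N + 1) ≤ N → P (2 * N + 1)
    P-intro N l≤k L≤N with ℕₚ.m≤n⇒∃[o]m+o≡n l≤k
    ... | L , refl with ℕₚ.m≤n⇒∃[o]m+o≡n (subst (_≤ N) (ℕₚ.m+n∸m≡n (2 * N + 1) L) L≤N)
    ... | t , refl =
      ceil3-≤ _ _ (subst (_≤ 3 * (2 * (L + t) + 1)) (sym (∸1+2 (1≤2k {L + t} l≤k)))
                         (subst (2 * (2 * (L + t) + 1 + L) + 1 ≤_) (total L t) (ℕₚ.m≤m+n _ (2 * t))))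
      , subst Odd (ℕₚ.+-comm 1 (2 * (L + t))) (odd-1+2* (L + t))
      where
      total : ∀ L t → 2 * (2 * (L + t) + 1 + L) + 1 + 2 * t ≡ 3 * (2 * (L + t) + 1)
      total = ℕ-Ring.solve-∀

    leg-bound : ∀ N → 2 * N + 1 ≤ k → ceil3 (2 * k ∸ 1) ≤ 2 * N + 1 → k ∸ (2 * N + 1) ≤ suc N
    leg-bound N l≤k ceil≤l with ℕₚ.m≤n⇒∃[o]m+o≡n l≤k
    ... | L , refl = subst (_≤ suc N) (sym (ℕₚ.m+n∸m≡n (2 * N + 1) L))
        (halve-≤ (2 * (2 * N + 1) + 1) (ℕₚ.+-monoˡ-≤ 2 (ceil3-≤⁻ _ _ ceil≤l)) (trans (∸1+2 (1≤2k {N} l≤k)) (lhs N L)) (rhs N))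
      where
      lhs : ∀ N L → 2 * (2 * N + 1 + L) + 1 ≡ 2 * (2 * N + 1) + 1 + 2 * L
      lhs = ℕ-Ring.solve-∀
      rhs : ∀ N → 3 * (2 * N + 1) + 2 ≡ 2 * (2 * N + 1) + 1 + 2 * suc N
      rhs = ℕ-Ring.solve-∀

    open GroupByArm (2 * j) j 1 k r refl (s≤s z≤n) (s≤s z≤n) P P-irrelevant P-intro P-elim

    summand : ℕ → PS
    summand l = qᶻ (expo m k h l) *ₚ qpoch (ℤ.- 1ℤ) 1 2 ((m ∸ 1) / 2) *ₚ q2q2Inv ∣ + k ℤ.- h ℤ.- 1ℤ ∣
                *ₚ gauss2 (+ k ℤ.- + l ℤ.+ ((+ 3 ℤ.* + l ℤ.- + 2 ℤ.* + k ℤ.- 1ℤ) /ℤ + 2)) (+ k ℤ.- + l)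

    counts-summands : ∀ l → l ≤ k → P l → summand l counts Term l
    counts-summands l l≤k p with P-elim p
    ... | N , refl = counts-summand {l} (expo-odd j r l≤k) half≡ (|k-h-1| k r) top≡ (+-∸ l≤k)
      where
      half≡ : (m ∸ 1) / 2 ≡ j
      half≡ = trans (cong (_/ 2) (ℕₚ.*-comm 2 j)) (m*n/n≡m j 2)
      top≡ : + k ℤ.- + l ℤ.+ (+ 3 ℤ.* + l ℤ.- + 2 ℤ.* + k ℤ.- 1ℤ) /ℤ + 2 ≡ + half l
      top≡ = trans (top-odd N l≤k (leg-bound N l≤k (proj₁ p))) (cong +_ (sym (half-2*+ N)))

    counts-GF : GF m k h counts HookPartitions m (suc r) k
    counts-GF = counts-≈ GF≈ (counts-HookPartitions P? summand counts-summands)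
      where
      GF≈ : GFodd m k h ≈ GF m k h
      GF≈ = coeffwise λ n → cong (λ b → (if b then GFodd m k h else GFeven m k h) n) (sym (dec-true (m % 2 ℕ.≟ 1) (odd-1+2* j)))

  module EvenColumn (j k r : ℕ) (1≤k : 1 ≤ k) where

    h : ℤ
    h = + k ℤ.- + suc r

    -- For l = 2N + 2, the lower limit ⌈2k/3⌉ ≤ l says that the leg k − l is at most N + 1.
    P : ℕ → Set
    P l = ceil3 (2 * k) ≤ l × l % 2 ≡ 0

    P? : Decidable P
    P? l = (ceil3 (2 * k) ≤? l) ×-dec (l % 2 ℕ.≟ 0)

    P-irrelevant : ∀ {l} (p q : P l) → p ≡ q
    P-irrelevant = ×-irrelevant ℕₚ.≤-irrelevant ℕₚ.≡-irrelevant

    P-elim : ∀ {l} → P l → Σ ℕ λ N → l ≡ 2 * N + 2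
    P-elim {l} (ceil≤l , l%2≡0) with parity l
    ... | inj₂ (p , refl)     = ⊥-elim (0≢1 (trans (sym l%2≡0) (odd-1+2* p)))
      where
      0≢1 : ¬ 0 ≡ 1
      0≢1 ()
    ... | inj₁ (zero  , refl) = ⊥-elim (ℕₚ.<⇒≱ (≤-ceil3 (2 * k) 1 (ℕₚ.+-mono-≤ (1≤2* 1≤k) (ℕₚ.≤-refl {2}))) ceil≤l)
    ... | inj₁ (suc N , refl) = N , shift N
      where
      shift : ∀ N → 2 * suc N ≡ 2 * N + 2
      shift = ℕ-Ring.solve-∀

    P-intro : ∀ N → 2 * N + 2 ≤ k → k ∸ (2 * N + 2) ≤ N → P (2 * N + 2)
    P-intro N l≤k L≤N with ℕₚ.m≤n⇒∃[o]m+o≡n l≤k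
    ... | L , refl with ℕₚ.m≤n⇒∃[o]m+o≡n (subst (_≤ N) (ℕₚ.m+n∸m≡n (2 * N + 2) L) L≤N)
    ... | t , refl =
      ceil3-≤ _ _ (subst (2 * (2 * (L + t) + 2 + L) + 2 ≤_) (total L t) (ℕₚ.m≤m+n _ (2 * t)))
      , trans (cong (_% 2) (shift (L + t))) (m*n%n≡0 (suc (L + t)) 2)
      where
      total : ∀ L t → 2 * (2 * (L + t) + 2 + L) + 2 + 2 * t ≡ 3 * (2 * (L + t) + 2)
      total = ℕ-Ring.solve-∀
      shift : ∀ N → 2 * N + 2 ≡ suc N * 2
      shift = ℕ-Ring.solve-∀

    leg-bound : ∀ N → 2 * N + 2 ≤ k → ceil3 (2 * k) ≤ 2 * N + 2 → k ∸ (2 * N + 2) ≤ suc N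
    leg-bound N l≤k ceil≤l with ℕₚ.m≤n⇒∃[o]m+o≡n l≤k
    ... | L , refl = subst (_≤ suc N) (sym (ℕₚ.m+n∸m≡n (2 * N + 2) L))
        (halve-≤ (2 * (2 * N + 2)) (ceil3-≤⁻ _ _ ceil≤l) (lhs N L) (rhs N))
      where
      lhs : ∀ N L → 2 * (2 * N + 2 + L) ≡ 2 * (2 * N + 2) + 2 * L
      lhs = ℕ-Ring.solve-∀
      rhs : ∀ N → 3 * (2 * N + 2) ≡ 2 * (2 * N + 2) + 2 * suc N
      rhs = ℕ-Ring.solve-∀

    2+m′≡1+2j : 2 + (1 + 2 * j) ≡ 1 + 2 * suc j
    2+m′≡1+2j = regroup j
      where
      regroup : ∀ j → 2 + (1 + 2 * j) ≡ 1 + 2 * suc j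
      regroup = ℕ-Ring.solve-∀

    open GroupByArm (1 + 2 * j) (suc j) 2 k r 2+m′≡1+2j (s≤s z≤n) ℕₚ.≤-refl P P-irrelevant P-intro P-elim

    summand : ℕ → PS
    summand l = qᶻ (+ k ℤ.- + l ℤ.+ expo m k h l) *ₚ qpoch (ℤ.- 1ℤ) 1 2 (m / 2) *ₚ q2q2Inv ∣ + k ℤ.- h ℤ.- 1ℤ ∣
                *ₚ gauss2 (+ k ℤ.- + l ℤ.+ ((+ 3 ℤ.* + l ℤ.- + 2 ℤ.* + k ℤ.- + 2) /ℤ + 2)) (+ k ℤ.- + l)

    counts-summands : ∀ l → l ≤ k → P l → summand l counts Term l
    counts-summands l l≤k p with P-elim p
    ... | N , refl = counts-summand {l} exponent≡ half≡ (|k-h-1| k r) top≡ (+-∸ l≤k)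
      where
      exponent≡ : + k ℤ.- + l ℤ.+ expo m k h l ≡ + exponent l
      exponent≡ = trans (expo-even j r l≤k)
        (cong (λ m₀ → + ((l + (1 + 2 * j)) + (offset-above 0 r (l + (1 + 2 * j)) + offset-between m₀ (k ∸ l)))) 2+m′≡1+2j)
      half≡ : m / 2 ≡ suc j
      half≡ = trans (cong (_/ 2) (double j)) (m*n/n≡m (suc j) 2)
        where
        double : ∀ j → suc (1 + 2 * j) ≡ suc j * 2
        double = ℕ-Ring.solve-∀
      top≡ : + k ℤ.- + l ℤ.+ (+ 3 ℤ.* + l ℤ.- + 2 ℤ.* + k ℤ.- + 2) /ℤ + 2 ≡ + half l
      top≡ = trans (top-even N l≤k (leg-bound N l≤k (proj₁ p))) (cong +_ (sym (half-2*+ N)))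

    counts-GF : GF m k h counts HookPartitions m (suc r) k
    counts-GF = counts-≈ GF≈ (counts-HookPartitions P? summand counts-summands)
      where
      GF≈ : GFeven m k h ≈ GF m k h
      GF≈ = coeffwise λ n → cong (λ b → (if b then GFodd m k h else GFeven m k h) n) (sym (dec-false (m % 2 ℕ.≟ 1) (even-¬odd j)))

  counts-GF : ∀ m′ k r → 1 ≤ k → GF (suc m′) k (+ k ℤ.- + suc r) counts HookPartitions (suc m′) (suc r) k
  counts-GF m′ k r 1≤k with parity m′
  ... | inj₁ (j , refl) = OddColumn.counts-GF j k r
  ... | inj₂ (j , refl) = EvenColumn.counts-GF j k r 1≤k

open import Defs
open import Data.Nat using (ℕ; suc; _≤_)
open import Data.Integer as ℤ using (ℤ; +_; 1ℤ)
open import Data.Fin using (Fin)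
open import Data.Product using (Σ; _×_; _,_)
open import Function.Bundles using (_↔_)
open import Function.Properties.Inverse using (↔-trans; ↔-sym)
open import Relation.Binary.PropositionalEquality using (_≡_; refl)

theorem3p6 : (m k : ℕ) (h : ℤ) → 1 ≤ m → 1 ≤ k → h ℤ.≤ + k ℤ.- 1ℤ →
    (n : ℕ) → Σ ℕ λ c → (GF m k h n ≡ + c) × (Fin c ↔ Counted m k h n)
theorem3p6 (suc m′) k h _ 1≤k h≤k-1 n with Assembly.row-of 1≤k h h≤k-1
... | r , refl =
  let c , GFₙ≡c , count = Assembly.counts-GF m′ k r 1≤k n
  in c , GFₙ≡c , ↔-trans count (↔-sym (Assembly.Counted↔HookPartitions (suc m′) k (+ k ℤ.- + suc r) n (Assembly.|k-h| k r)))
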